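{- Let $A_n(x)=\sum_{\pi\in S_n(321)}x^{f(\pi)}$. Then for every $n\ge0$, $A_n(x)$ equals the coefficient of $t^n$ in the Maclaurin expansion with respect to $t$ of $$\frac{1-x+\psi(t)}{2-x+t(x-1)^2},\qquad \psi(t)=\frac{1-\sqrt{1-4t}}{2t}=\sum_{m\ge0}C_mt^m.$$
   Context: $S_n(321)$ is the set of permutations $\pi=\pi_1\cdots\pi_n$ of $\{1,\dots,n\}$ with no indices $i<j<l$ such that $\pi_i>\pi_j>\pi_l$; $f(\pi)$ is the number of fixed points of $\pi$ (indices $i$ with $\pi_i=i$). $C_m=\frac{1}{m+1}\binom{2m}{m}$ is the $m$-th Catalan number. -}

module Defs where

open import Data.Bool using (Bool; true; false; _∧_; not)
open import Data.Nat as ℕ using (ℕ; zero; suc)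
open import Data.Nat.Combinatorics using (_C_)
open import Data.Fin as Fin using (Fin; toℕ)
open import Data.Vec as Vec using (Vec; []; _∷_; lookup)
open import Data.List as List using (List; []; _∷_; [_]; map; foldr; concatMap; filterᵇ; allFin; upTo; zipWith)
open import Data.Bool.ListAction using (all; any)
open import Relation.Nullary.Decidable using (⌊_⌋)
open import Data.Integer using (+_)
open import Data.Rational as ℚ using (ℚ; 0ℚ; 1ℚ; _+_; _*_; _-_; 1/_; NonZero)

_^ℚ_ : ℚ → ℕ → ℚ
x ^ℚ zero = 1ℚ
x ^ℚ suc k = x * (x ^ℚ k)

sumℚ : List ℚ → ℚ
sumℚ = foldr _+_ 0ℚ

ℕ→ℚ : ℕ → ℚ
ℕ→ℚ n = + n ℚ./ 1

-- Permutations of {1..n} in one-line notation, as words π : Vec (Fin n) n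
-- (position i ↦ value π_i, both 0-based).

allWords : (k n : ℕ) → List (Vec (Fin n) k)
allWords zero    n = [ [] ]
allWords (suc k) n = concatMap (λ v → map (λ a → a ∷ v) (allFin n)) (allWords k n)

isPerm : ∀ {n} → Vec (Fin n) n → Bool
isPerm {n} π = all (λ i → all (λ j → not ⌊ i Fin.<? j ⌋ ∨' not ⌊ lookup π i Fin.≟ lookup π j ⌋) (allFin n)) (allFin n)
  where
  _∨'_ : Bool → Bool → Bool
  true  ∨' _ = true
  false ∨' b = b

avoids321 : ∀ {n} → Vec (Fin n) n → Bool
avoids321 {n} π = not (any (λ i → any (λ j → any (λ l →
  ⌊ i Fin.<? j ⌋ ∧ ⌊ j Fin.<? l ⌋ ∧ ⌊ lookup π j Fin.<? lookup π i ⌋ ∧ ⌊ lookup π l Fin.<? lookup π j ⌋)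
  (allFin n)) (allFin n)) (allFin n))

S321 : (n : ℕ) → List (Vec (Fin n) n)
S321 n = filterᵇ (λ π → isPerm π ∧ avoids321 π) (allWords n n)

fix : ∀ {n} → Vec (Fin n) n → ℕ
fix {n} π = List.length (filterᵇ (λ i → ⌊ lookup π i Fin.≟ i ⌋) (allFin n))

A : ℕ → ℚ → ℚ
A n x = sumℚ (map (λ π → x ^ℚ fix π) (S321 n))

catalan : ℕ → ℕ
catalan m = ((2 ℕ.* m) C m) ℕ./ suc m

-- Formal power series in t with rational coefficients: ℕ → ℚ.
-- Quotient N / D of power series when D 0 ≠ 0 (Maclaurin coefficients):
-- q_n = (N_n - Σ_{k=1}^{n} D_k q_{n-k}) / D_0.

-- divRev N D n = [q_n , q_{n-1} , … , q_0]
divRev : (N D : ℕ → ℚ) → .{{NonZero (D 0)}} → ℕ → List ℚ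
divRev N D zero    = [ N 0 * 1/ (D 0) ]
divRev N D (suc n) = ((N (suc n) - conv) * 1/ (D 0)) ∷ prev
  where
  prev = divRev N D n
  conv = sumℚ (zipWith _*_ (map (λ k → D (suc k)) (upTo (suc n))) prev)

headℚ : List ℚ → ℚ
headℚ []      = 0ℚ
headℚ (q ∷ _) = q

seriesDiv : (N D : ℕ → ℚ) → .{{NonZero (D 0)}} → ℕ → ℚ
seriesDiv N D n = headℚ (divRev N D n)

ψ : ℕ → ℚ
ψ m = ℕ→ℚ (catalan m)

numer : ℚ → ℕ → ℚ
numer x zero    = 1ℚ - x + ψ 0
numer x (suc m) = ψ (suc m)

denom : ℚ → ℕ → ℚ
denom x zero          = ℕ→ℚ 2 - x
denom x (suc zero)    = (x - 1ℚ) * (x - 1ℚ)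
denom x (suc (suc _)) = 0ℚ

-- Read from right to left, a 321-avoiding permutation is built by repeatedly prepending either a new
-- minimum or the largest value not yet used, so it is a path in a generating tree whose state is the
-- number j of entries still to place and the number h of unused values above the current minimum.
-- Weighting each fixed point by x gives a table T x j h with A_n(x) = T x n 0. Differencing the
-- recurrence of T in h yields (2 − x) T x (m+1) 0 + (x − 1)² T x m 0 = T 1 (m+1) 0, and T 1 k 0 are
-- the ballot numbers C(2k, k) − C(2k, k+1) = C_k. These are exactly the coefficient identities of
-- (2 − x + t (x − 1)²) · Σ A_n(x) tⁿ = 1 − x + ψ(t).

module Submission where

import Data.Nat.Properties as ℕₚ
import Data.Rational.Properties as ℚₚ
open import Algebra.Properties.Group ℚₚ.+-0-group using () renaming (∙-cancelʳ to +-cancelʳ)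
open import Data.Bool as Bool using (Bool; true; false; not; _∧_; if_then_else_)
open import Data.Bool.ListAction using (all; any)
open import Data.Bool.Properties using (T-∧)
open import Data.Empty using (⊥; ⊥-elim)
open import Data.Fin as Fin using (Fin; toℕ; fromℕ<)
import Data.Fin.Properties as Finₚ
import Data.Integer as ℤ
open import Data.List using (List; []; _∷_; _++_; [_]; length; map; zipWith; upTo; applyUpTo; allFin; filterᵇ; concatMap; tabulate)
import Data.List.Properties as Listₚ
open import Data.List.Membership.DecPropositional ℕₚ._≟_ using (_∈?_)
open import Data.List.Membership.Propositional using (_∈_; _∉_; lose)
open import Data.List.Membership.Propositional.Properties using (∈-++⁻; ∈-allFin)
open import Data.List.Relation.Unary.All as All using (All; []; _∷_)
open import Data.List.Relation.Unary.All.Properties using (all⁺; all⁻; ¬All⇒Any¬)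
open import Data.List.Relation.Unary.Any using (Any; here; there; satisfied)
open import Data.List.Relation.Unary.Any.Properties using (any⁺; any⁻)
open import Data.Nat as ℕ using (ℕ; zero; suc; _∸_; _<_; _≤_; _⊓_; z≤n; s≤s; _<?_)
open import Data.Nat.Combinatorics using (_C_; nCk+nC[k+1]≡[n+1]C[k+1]; nCn≡1; nC1≡n; nCk≡nC[n∸k]; k>n⇒nCk≡0)
open import Data.Nat.Coprimality using (1-coprimeTo)
open import Data.Nat.DivMod using (m*n/n≡m)
import Data.Nat.Solver as ℕSolver
open import Data.Product using (∃; _×_; _,_; proj₁; proj₂)
open import Data.Rational as ℚ using (ℚ; 0ℚ; 1ℚ; _+_; _*_; _-_; 1/_; NonZero; mkℚ)
open import Data.Rational.Solver using (module +-*-Solver)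
open import Data.Sum using (_⊎_; inj₁; inj₂)
open import Data.Unit using (⊤; tt)
open import Data.Vec using (Vec; []; _∷_; lookup)
open import Function using (_∘_; Equivalence; case_of_)
open import Relation.Binary.Definitions using (tri<; tri≈; tri>)
open import Relation.Binary.PropositionalEquality hiding ([_])
open import Relation.Nullary using (¬_; Dec; does; yes; no)
open import Relation.Nullary.Decidable using (⌊_⌋; T?; dec-true; dec-false; _×-dec_; _⊎-dec_; _→-dec_; ¬?)
open import Defs

open ≡-Reasoning
open +-*-Solver
module ℕS = ℕSolver.+-*-Solver

∑< : ℕ → (ℕ → ℚ) → ℚ
∑< zero    f = 0ℚ
∑< (suc m) f = ∑< m f + f m

∑<-cong : ∀ m {f g : ℕ → ℚ} → (∀ {i} → i < m → f i ≡ g i) → ∑< m f ≡ ∑< m g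
∑<-cong zero    f≡g = refl
∑<-cong (suc m) f≡g = cong₂ _+_ (∑<-cong m (λ i<m → f≡g (ℕₚ.m<n⇒m<1+n i<m))) (f≡g (ℕₚ.n<1+n m))

∑<-≡0 : ∀ m {f : ℕ → ℚ} → (∀ {i} → i < m → f i ≡ 0ℚ) → ∑< m f ≡ 0ℚ
∑<-≡0 m f≡0 = trans (∑<-cong m f≡0) (∑<-0 m)
  where
  ∑<-0 : ∀ m → ∑< m (λ _ → 0ℚ) ≡ 0ℚ
  ∑<-0 zero    = refl
  ∑<-0 (suc m) = cong (_+ 0ℚ) (∑<-0 m)

∑<-single : ∀ m {f : ℕ → ℚ} {t} → t < m → (∀ {i} → i < m → i ≢ t → f i ≡ 0ℚ) → ∑< m f ≡ f t
∑<-single (suc m) {f} {t} t<1+m others with ℕₚ.m≤n⇒m<n∨m≡n (ℕₚ.≤-pred t<1+m)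
... | inj₂ refl = trans (cong (_+ f m) (∑<-≡0 m (λ i<m → others (ℕₚ.m<n⇒m<1+n i<m) (ℕₚ.<⇒≢ i<m)))) (ℚₚ.+-identityˡ (f m))
... | inj₁ t<m  = trans (cong₂ _+_ (∑<-single m t<m (λ i<m → others (ℕₚ.m<n⇒m<1+n i<m)))
                                   (others (ℕₚ.n<1+n m) (λ m≡t → ℕₚ.<-irrefl (sym m≡t) t<m)))
                        (ℚₚ.+-identityʳ (f t))

∑<-+ : ∀ a b (f : ℕ → ℚ) → ∑< (a ℕ.+ b) f ≡ ∑< a f + ∑< b (λ t → f (a ℕ.+ t))
∑<-+ a zero    f = trans (cong (λ m → ∑< m f) (ℕₚ.+-identityʳ a)) (sym (ℚₚ.+-identityʳ _))
∑<-+ a (suc b) f = begin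
  ∑< (a ℕ.+ suc b) f                                   ≡⟨ cong (λ m → ∑< m f) (ℕₚ.+-suc a b) ⟩
  ∑< (a ℕ.+ b) f + f (a ℕ.+ b)                         ≡⟨ cong (_+ f (a ℕ.+ b)) (∑<-+ a b f) ⟩
  ∑< a f + ∑< b (λ t → f (a ℕ.+ t)) + f (a ℕ.+ b)      ≡⟨ ℚₚ.+-assoc (∑< a f) _ _ ⟩
  ∑< a f + ∑< (suc b) (λ t → f (a ℕ.+ t))              ∎

∑<-distribˡ : ∀ m c (f : ℕ → ℚ) → ∑< m (λ i → c * f i) ≡ c * ∑< m f
∑<-distribˡ zero    c f = sym (ℚₚ.*-zeroʳ c)
∑<-distribˡ (suc m) c f = trans (cong (_+ c * f m) (∑<-distribˡ m c f)) (sym (ℚₚ.*-distribˡ-+ c (∑< m f) (f m)))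

∑<-suc : ∀ m (f : ℕ → ℚ) → ∑< (suc m) f ≡ f 0 + ∑< m (λ i → f (suc i))
∑<-suc zero    f = trans (ℚₚ.+-identityˡ (f 0)) (sym (ℚₚ.+-identityʳ (f 0)))
∑<-suc (suc m) f = trans (cong (_+ f (suc m)) (∑<-suc m f)) (ℚₚ.+-assoc (f 0) _ _)

ℕ→ℚ-suc : ∀ n → ℕ→ℚ (suc n) ≡ 1ℚ + ℕ→ℚ n
ℕ→ℚ-suc zero    = refl
ℕ→ℚ-suc (suc n) = trans (cong (λ m → ℤ.+ suc m ℚ./ 1) (sym (ℕₚ.*-identityʳ (suc n))))
                        (cong (1ℚ +_) (sym (ℚₚ.↥p/↧p≡p (mkℚ (ℤ.+ suc n) 0 (Data.Nat.Coprimality.sym (1-coprimeTo (suc n)))))))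

ℕ→ℚ-+ : ∀ a b → ℕ→ℚ (a ℕ.+ b) ≡ ℕ→ℚ a + ℕ→ℚ b
ℕ→ℚ-+ zero    b = sym (ℚₚ.+-identityˡ _)
ℕ→ℚ-+ (suc a) b = begin
  ℕ→ℚ (suc (a ℕ.+ b))      ≡⟨ ℕ→ℚ-suc (a ℕ.+ b) ⟩
  1ℚ + ℕ→ℚ (a ℕ.+ b)       ≡⟨ cong (1ℚ +_) (ℕ→ℚ-+ a b) ⟩
  1ℚ + (ℕ→ℚ a + ℕ→ℚ b)     ≡⟨ sym (ℚₚ.+-assoc 1ℚ (ℕ→ℚ a) (ℕ→ℚ b)) ⟩
  1ℚ + ℕ→ℚ a + ℕ→ℚ b       ≡⟨ cong (_+ ℕ→ℚ b) (sym (ℕ→ℚ-suc a)) ⟩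
  ℕ→ℚ (suc a) + ℕ→ℚ b      ∎

-- T x (suc j) h: a new minimum i leaves height j ∸ i and is a fixed point iff that height is 0;
-- the largest unused value, available only if h > 0, leaves height h ∸ 1 and is never a fixed point.
fixWeight : ℚ → ℕ → ℚ
fixWeight x zero    = x
fixWeight x (suc _) = 1ℚ

T : ℚ → ℕ → ℕ → ℚ
newMin : ℚ → ℕ → ℕ → ℚ

T x zero    zero    = 1ℚ
T x zero    (suc h) = 0ℚ
T x (suc j) zero    = ∑< (suc j) (newMin x j)
T x (suc j) (suc h) = ∑< (j ∸ h) (newMin x j) + T x j h

newMin x j i = fixWeight x (j ∸ i) * T x j (j ∸ i)

T-above : ∀ x j h → j < h → T x j h ≡ 0ℚ
T-above x zero    (suc h) _          = refl
T-above x (suc j) (suc h) (s≤s j<h) = begin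
  ∑< (j ∸ h) (newMin x j) + T x j h
    ≡⟨ cong₂ (λ m t → ∑< m (newMin x j) + t) (ℕₚ.m≤n⇒m∸n≡0 (ℕₚ.<⇒≤ j<h)) (T-above x j h j<h) ⟩
  0ℚ + 0ℚ
    ≡⟨⟩
  0ℚ ∎

T-diag : ∀ x j → T x j j ≡ 1ℚ
T-diag x zero    = refl
T-diag x (suc j) = cong₂ (λ m t → ∑< m (newMin x j) + t) (ℕₚ.n∸n≡0 j) (T-diag x j)

T-suc-suc : ∀ x j h → T x (suc j) (suc h) ≡ T x (suc j) (suc (suc h)) + T x j h
T-suc-suc x j h with ℕₚ.<-cmp h j
... | tri< h<j _ _ = begin
  ∑< (j ∸ h) (newMin x j) + T x j h
    ≡⟨ cong (λ m → ∑< m (newMin x j) + T x j h) (ℕₚ.+-∸-assoc 1 h<j) ⟩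
  ∑< (j ∸ suc h) (newMin x j) + fixWeight x (j ∸ (j ∸ suc h)) * T x j (j ∸ (j ∸ suc h)) + T x j h
    ≡⟨ cong (λ m → ∑< (j ∸ suc h) (newMin x j) + fixWeight x m * T x j m + T x j h) (ℕₚ.m∸[m∸n]≡n h<j) ⟩
  ∑< (j ∸ suc h) (newMin x j) + 1ℚ * T x j (suc h) + T x j h
    ≡⟨ cong (λ t → ∑< (j ∸ suc h) (newMin x j) + t + T x j h) (ℚₚ.*-identityˡ _) ⟩
  ∑< (j ∸ suc h) (newMin x j) + T x j (suc h) + T x j h ∎
... | tri≈ _ refl _ = begin
  ∑< (j ∸ j) (newMin x j) + T x j j
    ≡⟨ cong (λ m → ∑< m (newMin x j) + T x j j) (ℕₚ.n∸n≡0 j) ⟩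
  0ℚ + T x j j
    ≡⟨ cong (λ t → 0ℚ + t + T x j j) (sym (T-above x j (suc j) ℕₚ.≤-refl)) ⟩
  0ℚ + T x j (suc j) + T x j j
    ≡⟨ cong (λ m → ∑< m (newMin x j) + T x j (suc j) + T x j j) (sym (ℕₚ.m≤n⇒m∸n≡0 (ℕₚ.n≤1+n j))) ⟩
  ∑< (j ∸ suc j) (newMin x j) + T x j (suc j) + T x j j ∎
... | tri> _ _ j<h = begin
  ∑< (j ∸ h) (newMin x j) + T x j h
    ≡⟨ cong (λ m → ∑< m (newMin x j) + T x j h) (ℕₚ.m≤n⇒m∸n≡0 (ℕₚ.<⇒≤ j<h)) ⟩
  0ℚ + T x j h
    ≡⟨ cong (λ t → 0ℚ + t + T x j h) (sym (T-above x j (suc h) (ℕₚ.m<n⇒m<1+n j<h))) ⟩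
  0ℚ + T x j (suc h) + T x j h
    ≡⟨ cong (λ m → ∑< m (newMin x j) + T x j (suc h) + T x j h) (sym (ℕₚ.m≤n⇒m∸n≡0 (ℕₚ.m≤n⇒m≤1+n (ℕₚ.<⇒≤ j<h)))) ⟩
  ∑< (j ∸ suc h) (newMin x j) + T x j (suc h) + T x j h ∎

T-suc-zero : ∀ x j → T x (suc j) 0 ≡ T x (suc j) 1 + (x - 1ℚ) * T x j 0
T-suc-zero x j = begin
  ∑< j (newMin x j) + fixWeight x (j ∸ j) * T x j (j ∸ j)
    ≡⟨ cong (λ m → ∑< j (newMin x j) + fixWeight x m * T x j m) (ℕₚ.n∸n≡0 j) ⟩
  ∑< j (newMin x j) + x * T x j 0
    ≡⟨ solve 3 (λ s x t → s :+ x :* t := s :+ t :+ (x :- con 1ℚ) :* t) refl (∑< j (newMin x j)) x (T x j 0) ⟩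
  ∑< j (newMin x j) + T x j 0 + (x - 1ℚ) * T x j 0 ∎

T↓ : ℚ → ℕ → ℕ → ℚ
T↓ x m zero    = 0ℚ
T↓ x m (suc h) = T x m h

T-suc : ∀ x j h → T x (suc j) h ≡ ∑< (suc j ∸ h) (newMin x j) + T↓ x j h
T-suc x j zero    = sym (ℚₚ.+-identityʳ _)
T-suc x j (suc h) = refl

T₁-step : ∀ m h → T 1ℚ (suc m) h ≡ T 1ℚ (suc m) (suc h) + T↓ 1ℚ m h
T₁-step m zero    = trans (T-suc-zero 1ℚ m) (cong (T 1ℚ (suc m) 1 +_) (ℚₚ.*-zeroˡ (T 1ℚ m 0)))
T₁-step m (suc h) = T-suc-suc 1ℚ m h

kernel : ℚ → ℚ → ℚ → ℚ → ℚ → ℚ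
kernel x a b c d = (ℕ→ℚ 2 - x) * a + (x - 1ℚ) * (x - 1ℚ) * b - c + (x - 1ℚ) * d

kernel-cong : ∀ x {a a′ b b′ c c′ d d′} → a ≡ a′ → b ≡ b′ → c ≡ c′ → d ≡ d′ →
              kernel x a b c d ≡ kernel x a′ b′ c′ d′
kernel-cong x refl refl refl refl = refl

kernel-+ : ∀ x a a′ b b′ c c′ d d′ →
           kernel x (a + a′) (b + b′) (c + c′) (d + d′) ≡ kernel x a b c d + kernel x a′ b′ c′ d′
kernel-+ = solve 9 (λ x a a′ b b′ c c′ d d′ →
  (con (ℕ→ℚ 2) :- x) :* (a :+ a′) :+ (x :- con 1ℚ) :* (x :- con 1ℚ) :* (b :+ b′) :- (c :+ c′) :+ (x :- con 1ℚ) :* (d :+ d′)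
  := ((con (ℕ→ℚ 2) :- x) :* a :+ (x :- con 1ℚ) :* (x :- con 1ℚ) :* b :- c :+ (x :- con 1ℚ) :* d)
     :+ ((con (ℕ→ℚ 2) :- x) :* a′ :+ (x :- con 1ℚ) :* (x :- con 1ℚ) :* b′ :- c′ :+ (x :- con 1ℚ) :* d′)) refl

kernel-+-scaled : ∀ x a a′ b b′ c d →
                  kernel x (a + (x - 1ℚ) * a′) (b + (x - 1ℚ) * b′) c 0ℚ ≡ kernel x a b c d + (x - 1ℚ) * kernel x a′ b′ d 0ℚ
kernel-+-scaled = solve 7 (λ x a a′ b b′ c d →
  (con (ℕ→ℚ 2) :- x) :* (a :+ (x :- con 1ℚ) :* a′) :+ (x :- con 1ℚ) :* (x :- con 1ℚ) :* (b :+ (x :- con 1ℚ) :* b′)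
    :- c :+ (x :- con 1ℚ) :* con 0ℚ
  := ((con (ℕ→ℚ 2) :- x) :* a :+ (x :- con 1ℚ) :* (x :- con 1ℚ) :* b :- c :+ (x :- con 1ℚ) :* d)
     :+ (x :- con 1ℚ) :* ((con (ℕ→ℚ 2) :- x) :* a′ :+ (x :- con 1ℚ) :* (x :- con 1ℚ) :* b′ :- d :+ (x :- con 1ℚ) :* con 0ℚ)) refl

kernel-0 : ∀ x → kernel x 0ℚ 0ℚ 0ℚ 0ℚ ≡ 0ℚ
kernel-0 = solve 1 (λ x →
  (con (ℕ→ℚ 2) :- x) :* con 0ℚ :+ (x :- con 1ℚ) :* (x :- con 1ℚ) :* con 0ℚ :- con 0ℚ :+ (x :- con 1ℚ) :* con 0ℚ := con 0ℚ) refl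

-- T-kernel-equation is defect x m 0 ≡ 0; only the statement for every height h survives induction on m.
defect : ℚ → ℕ → ℕ → ℚ
defect x m h = kernel x (T x (suc m) h) (T x m h) (T 1ℚ (suc m) h) (T↓ 1ℚ m h)

defect-suc : ∀ x m → (∀ h → defect x m h ≡ 0ℚ) → ∀ h → defect x (suc m) (suc h) ≡ defect x (suc m) (suc (suc h))
defect-suc x m defect-m≡0 h = begin
  defect x (suc m) (suc h)
    ≡⟨ kernel-cong x (T-suc-suc x (suc m) h) (T-suc-suc x m h)
                     (trans (T-suc-suc 1ℚ (suc m) h) (cong (T 1ℚ (suc (suc m)) (suc (suc h)) +_) T₁≡)) T₁≡ ⟩
  kernel x (T x (suc (suc m)) (suc (suc h)) + T x (suc m) h) (T x (suc m) (suc (suc h)) + T x m h)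
           (T 1ℚ (suc (suc m)) (suc (suc h)) + (T 1ℚ (suc m) (suc h) + T↓ 1ℚ m h)) (T 1ℚ (suc m) (suc h) + T↓ 1ℚ m h)
    ≡⟨ kernel-+ x _ _ _ _ _ _ _ _ ⟩
  defect x (suc m) (suc (suc h)) + kernel x (T x (suc m) h) (T x m h) (T 1ℚ (suc m) (suc h) + T↓ 1ℚ m h) (T↓ 1ℚ m h)
    ≡⟨ cong (defect x (suc m) (suc (suc h)) +_) (trans (kernel-cong x refl refl (sym T₁≡) refl) (defect-m≡0 h)) ⟩
  defect x (suc m) (suc (suc h)) + 0ℚ
    ≡⟨ ℚₚ.+-identityʳ _ ⟩
  defect x (suc m) (suc (suc h)) ∎
  where
  T₁≡ : T 1ℚ (suc m) h ≡ T 1ℚ (suc m) (suc h) + T↓ 1ℚ m h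
  T₁≡ = T₁-step m h

defect-suc-zero : ∀ x m → defect x (suc m) 0 ≡ defect x (suc m) 1 + (x - 1ℚ) * defect x m 0
defect-suc-zero x m = begin
  defect x (suc m) 0
    ≡⟨ kernel-cong x (T-suc-zero x (suc m)) (T-suc-zero x m) (trans (T₁-step (suc m) 0) (ℚₚ.+-identityʳ _)) refl ⟩
  kernel x (T x (suc (suc m)) 1 + (x - 1ℚ) * T x (suc m) 0) (T x (suc m) 1 + (x - 1ℚ) * T x m 0) (T 1ℚ (suc (suc m)) 1) 0ℚ
    ≡⟨ kernel-+-scaled x _ _ _ _ _ _ ⟩
  defect x (suc m) 1 + (x - 1ℚ) * defect x m 0 ∎

defect-above : ∀ x m h → suc m < h → defect x m h ≡ 0ℚ
defect-above x m (suc h) (s≤s m<h) = trans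
  (kernel-cong x (T-above x (suc m) (suc h) (s≤s m<h)) (T-above x m (suc h) (ℕₚ.m<n⇒m<1+n m<h))
                 (T-above 1ℚ (suc m) (suc h) (s≤s m<h)) (T-above 1ℚ m h m<h))
  (kernel-0 x)

defect-climb : ∀ x m → (∀ h → defect x m h ≡ 0ℚ) → ∀ d h → defect x (suc m) (suc h) ≡ defect x (suc m) (d ℕ.+ suc h)
defect-climb x m defect-m≡0 zero    h = refl
defect-climb x m defect-m≡0 (suc d) h = begin
  defect x (suc m) (suc h)             ≡⟨ defect-suc x m defect-m≡0 h ⟩
  defect x (suc m) (suc (suc h))       ≡⟨ defect-climb x m defect-m≡0 d (suc h) ⟩
  defect x (suc m) (d ℕ.+ suc (suc h)) ≡⟨ cong (defect x (suc m)) (ℕₚ.+-suc d (suc h)) ⟩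
  defect x (suc m) (suc d ℕ.+ suc h)   ∎

defect-suc≡0 : ∀ x m → (∀ h → defect x m h ≡ 0ℚ) → ∀ h → defect x (suc m) (suc h) ≡ 0ℚ
defect-suc≡0 x m defect-m≡0 h = trans (defect-climb x m defect-m≡0 (3 ℕ.+ m) h)
  (defect-above x (suc m) _ (s≤s (s≤s (s≤s (ℕₚ.m≤m+n m (suc h))))))

defect≡0 : ∀ x m h → defect x m h ≡ 0ℚ
defect≡0 x zero zero = solve 1 (λ x → (con (ℕ→ℚ 2) :- x) :* (con 0ℚ :+ x :* con 1ℚ) :+ (x :- con 1ℚ) :* (x :- con 1ℚ) :* con 1ℚ
                                    :- (con 0ℚ :+ con 1ℚ :* con 1ℚ) :+ (x :- con 1ℚ) :* con 0ℚ := con 0ℚ) refl x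
defect≡0 x zero (suc zero) = solve 1 (λ x → (con (ℕ→ℚ 2) :- x) :* (con 0ℚ :+ con 1ℚ) :+ (x :- con 1ℚ) :* (x :- con 1ℚ) :* con 0ℚ
                                    :- (con 0ℚ :+ con 1ℚ) :+ (x :- con 1ℚ) :* con 1ℚ := con 0ℚ) refl x
defect≡0 x zero (suc (suc h)) = defect-above x zero (suc (suc h)) (s≤s (s≤s z≤n))
defect≡0 x (suc m) (suc h) = defect-suc≡0 x m (defect≡0 x m) h
defect≡0 x (suc m) zero = begin
  defect x (suc m) 0
    ≡⟨ defect-suc-zero x m ⟩
  defect x (suc m) 1 + (x - 1ℚ) * defect x m 0
    ≡⟨ cong₂ (λ a b → a + (x - 1ℚ) * b) (defect-suc≡0 x m (defect≡0 x m) 0) (defect≡0 x m 0) ⟩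
  0ℚ + (x - 1ℚ) * 0ℚ
    ≡⟨ solve 1 (λ x → con 0ℚ :+ (x :- con 1ℚ) :* con 0ℚ := con 0ℚ) refl x ⟩
  0ℚ ∎

T-kernel-equation : ∀ x m → (ℕ→ℚ 2 - x) * T x (suc m) 0 + (x - 1ℚ) * (x - 1ℚ) * T x m 0 ≡ T 1ℚ (suc m) 0
T-kernel-equation x m = begin
  (ℕ→ℚ 2 - x) * a + (x - 1ℚ) * (x - 1ℚ) * b ≡⟨ solve 4 (λ x a b c → (con (ℕ→ℚ 2) :- x) :* a :+ (x :- con 1ℚ) :* (x :- con 1ℚ) :* b
        := ((con (ℕ→ℚ 2) :- x) :* a :+ (x :- con 1ℚ) :* (x :- con 1ℚ) :* b :- c :+ (x :- con 1ℚ) :* con 0ℚ) :+ c) refl x a b c ⟩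
  defect x m 0 + c                           ≡⟨ cong (_+ c) (defect≡0 x m 0) ⟩
  0ℚ + c                                     ≡⟨ ℚₚ.+-identityˡ c ⟩
  c                                          ∎
  where
  a = T x (suc m) 0
  b = T x m 0
  c = T 1ℚ (suc m) 0

nC0≡1 : ∀ n → n C 0 ≡ 1
nC0≡1 n = trans (nCk≡nC[n∸k] {0} {n} z≤n) (nCn≡1 n)

[k+1]*[n+1]C[k+1]≡[n+1]*nCk : ∀ n k → suc k ℕ.* (suc n C suc k) ≡ suc n ℕ.* (n C k)
[k+1]*[n+1]C[k+1]≡[n+1]*nCk zero zero = refl
[k+1]*[n+1]C[k+1]≡[n+1]*nCk zero (suc k) = begin
  suc (suc k) ℕ.* (1 C suc (suc k)) ≡⟨ cong (suc (suc k) ℕ.*_) (k>n⇒nCk≡0 {1} {suc (suc k)} (s≤s (s≤s z≤n))) ⟩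
  suc (suc k) ℕ.* 0                 ≡⟨ ℕₚ.*-zeroʳ (suc (suc k)) ⟩
  0                                 ≡⟨ cong (1 ℕ.*_) (sym (k>n⇒nCk≡0 {0} {suc k} (s≤s z≤n))) ⟩
  1 ℕ.* (0 C suc k)                 ∎
[k+1]*[n+1]C[k+1]≡[n+1]*nCk (suc n) zero = begin
  1 ℕ.* (suc (suc n) C 1)      ≡⟨ cong (1 ℕ.*_) (nC1≡n (suc (suc n))) ⟩
  1 ℕ.* suc (suc n)            ≡⟨ ℕₚ.*-comm 1 (suc (suc n)) ⟩
  suc (suc n) ℕ.* 1            ≡⟨ cong (suc (suc n) ℕ.*_) (sym (nC0≡1 (suc n))) ⟩
  suc (suc n) ℕ.* (suc n C 0)  ∎
[k+1]*[n+1]C[k+1]≡[n+1]*nCk (suc n) (suc k) = begin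
  suc (suc k) ℕ.* (suc (suc n) C suc (suc k))
    ≡⟨ cong (suc (suc k) ℕ.*_) (sym (nCk+nC[k+1]≡[n+1]C[k+1] (suc n) (suc k))) ⟩
  suc (suc k) ℕ.* (a ℕ.+ b)
    ≡⟨ ℕS.solve 3 (λ k a b → (ℕS.con 1 ℕS.:+ k) ℕS.:* (a ℕS.:+ b) ℕS.:= a ℕS.:+ k ℕS.:* a ℕS.:+ (ℕS.con 1 ℕS.:+ k) ℕS.:* b)
                  refl (suc k) a b ⟩
  a ℕ.+ suc k ℕ.* a ℕ.+ suc (suc k) ℕ.* b
    ≡⟨ cong₂ (λ u v → a ℕ.+ u ℕ.+ v) ([k+1]*[n+1]C[k+1]≡[n+1]*nCk n k) ([k+1]*[n+1]C[k+1]≡[n+1]*nCk n (suc k)) ⟩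
  a ℕ.+ suc n ℕ.* (n C k) ℕ.+ suc n ℕ.* (n C suc k)
    ≡⟨ ℕS.solve 4 (λ a n u v → a ℕS.:+ n ℕS.:* u ℕS.:+ n ℕS.:* v ℕS.:= a ℕS.:+ n ℕS.:* (u ℕS.:+ v))
                  refl a (suc n) (n C k) (n C suc k) ⟩
  a ℕ.+ suc n ℕ.* (n C k ℕ.+ n C suc k)
    ≡⟨ cong (λ z → a ℕ.+ suc n ℕ.* z) (nCk+nC[k+1]≡[n+1]C[k+1] n k) ⟩
  suc (suc n) ℕ.* a ∎
  where
  a = suc n C suc k
  b = suc n C suc (suc k)

-- T 1ℚ k h ≡ C(2k − h, k) − C(2k − h, k + 1), stated with t = 2k − h and without subtraction.
Ballot : ℕ → ℕ → ℕ → Set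
Ballot k h t = T 1ℚ k h + ℕ→ℚ (t C suc k) ≡ ℕ→ℚ (t C k)

ballot-diag : ∀ h → Ballot h h h
ballot-diag h = begin
  T 1ℚ h h + ℕ→ℚ (h C suc h) ≡⟨ cong₂ (λ a b → a + ℕ→ℚ b) (T-diag 1ℚ h) (k>n⇒nCk≡0 (ℕₚ.n<1+n h)) ⟩
  1ℚ + 0ℚ                    ≡⟨ cong ℕ→ℚ (sym (nCn≡1 h)) ⟩
  ℕ→ℚ (h C h)                ∎

ballot-pascal : ∀ k t {a b} → a + ℕ→ℚ (t C suc (suc k)) + (b + ℕ→ℚ (t C suc k)) ≡ ℕ→ℚ (t C suc k) + ℕ→ℚ (t C k) →
                a + b + ℕ→ℚ (suc t C suc (suc k)) ≡ ℕ→ℚ (suc t C suc k)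
ballot-pascal k t {a} {b} sum≡ = begin
  a + b + ℕ→ℚ (suc t C suc (suc k))
    ≡⟨ cong (λ z → a + b + ℕ→ℚ z) (sym (nCk+nC[k+1]≡[n+1]C[k+1] t (suc k))) ⟩
  a + b + ℕ→ℚ (b₀ ℕ.+ b₊)
    ≡⟨ cong (a + b +_) (ℕ→ℚ-+ b₀ b₊) ⟩
  a + b + (ℕ→ℚ b₀ + ℕ→ℚ b₊)
    ≡⟨ solve 4 (λ a b c d → a :+ b :+ (c :+ d) := a :+ d :+ (b :+ c)) refl a b (ℕ→ℚ b₀) (ℕ→ℚ b₊) ⟩
  a + ℕ→ℚ b₊ + (b + ℕ→ℚ b₀)
    ≡⟨ sum≡ ⟩
  ℕ→ℚ b₀ + ℕ→ℚ (t C k)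
    ≡⟨ ℚₚ.+-comm (ℕ→ℚ b₀) _ ⟩
  ℕ→ℚ (t C k) + ℕ→ℚ b₀
    ≡⟨ sym (ℕ→ℚ-+ (t C k) b₀) ⟩
  ℕ→ℚ (t C k ℕ.+ b₀)
    ≡⟨ cong ℕ→ℚ (nCk+nC[k+1]≡[n+1]C[k+1] t k) ⟩
  ℕ→ℚ (suc t C suc k) ∎
  where
  b₀ = t C suc k
  b₊ = t C suc (suc k)

ballot-suc : ∀ m h t → Ballot (suc m) (suc (suc h)) t → Ballot m h t → Ballot (suc m) (suc h) (suc t)
ballot-suc m h t up down = begin
  T 1ℚ (suc m) (suc h) + ℕ→ℚ (suc t C suc (suc m))
    ≡⟨ cong (_+ ℕ→ℚ (suc t C suc (suc m))) (T-suc-suc 1ℚ m h) ⟩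
  T 1ℚ (suc m) (suc (suc h)) + T 1ℚ m h + ℕ→ℚ (suc t C suc (suc m))
    ≡⟨ ballot-pascal m t {T 1ℚ (suc m) (suc (suc h))} {T 1ℚ m h} (cong₂ _+_ up down) ⟩
  ℕ→ℚ (suc t C suc m) ∎

ballot-zero : ∀ m → Ballot (suc m) 1 (m ℕ.+ suc m) → Ballot (suc m) 0 (suc (m ℕ.+ suc m))
ballot-zero m up = begin
  T 1ℚ (suc m) 0 + ℕ→ℚ (suc t C suc (suc m))
    ≡⟨ cong (_+ ℕ→ℚ (suc t C suc (suc m))) (T₁-step m 0) ⟩
  T 1ℚ (suc m) 1 + 0ℚ + ℕ→ℚ (suc t C suc (suc m))
    ≡⟨ ballot-pascal m t {T 1ℚ (suc m) 1} {0ℚ} (cong₂ _+_ up (trans (ℚₚ.+-identityˡ _) (cong ℕ→ℚ central))) ⟩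
  ℕ→ℚ (suc t C suc m) ∎
  where
  t = m ℕ.+ suc m
  central : t C suc m ≡ t C m
  central = sym (trans (nCk≡nC[n∸k] (ℕₚ.m≤m+n m (suc m))) (cong (t C_) (ℕₚ.m+n∸m≡n m (suc m))))

ballot : ∀ d h → Ballot (h ℕ.+ d) h (h ℕ.+ (d ℕ.+ d))
ballot zero    h       = subst (λ k → Ballot k h k) (sym (ℕₚ.+-identityʳ h)) (ballot-diag h)
ballot (suc d) zero    = ballot-zero d (subst (Ballot (suc d) 1) (sym (ℕₚ.+-suc d d)) (ballot d 1))
ballot (suc d) (suc h) = ballot-suc (h ℕ.+ suc d) h (h ℕ.+ suc (d ℕ.+ suc d))
  (subst₂ (λ k t → Ballot k (suc (suc h)) t) k≡ t≡ (ballot d (suc (suc h)))) (ballot (suc d) h)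
  where
  k≡ : suc (suc (h ℕ.+ d)) ≡ suc (h ℕ.+ suc d)
  k≡ = cong suc (sym (ℕₚ.+-suc h d))
  t≡ : suc (suc (h ℕ.+ (d ℕ.+ d))) ≡ h ℕ.+ suc (d ℕ.+ suc d)
  t≡ = ℕS.solve 2 (λ h d → ℕS.con 2 ℕS.:+ (h ℕS.:+ (d ℕS.:+ d)) ℕS.:= h ℕS.:+ (ℕS.con 1 ℕS.:+ (d ℕS.:+ (ℕS.con 1 ℕS.:+ d))))
                  refl h d

[k+1]*[2k]C[k+1]≡k*[2k]Ck : ∀ k → suc k ℕ.* ((k ℕ.+ k) C suc k) ≡ k ℕ.* ((k ℕ.+ k) C k)
[k+1]*[2k]C[k+1]≡k*[2k]Ck k = ℕₚ.+-cancelˡ-≡ (suc k ℕ.* c) _ _ (begin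
  suc k ℕ.* c ℕ.+ suc k ℕ.* d
    ≡⟨ sym (ℕₚ.*-distribˡ-+ (suc k) c d) ⟩
  suc k ℕ.* (c ℕ.+ d)
    ≡⟨ cong (suc k ℕ.*_) (nCk+nC[k+1]≡[n+1]C[k+1] (k ℕ.+ k) k) ⟩
  suc k ℕ.* (suc (k ℕ.+ k) C suc k)
    ≡⟨ [k+1]*[n+1]C[k+1]≡[n+1]*nCk (k ℕ.+ k) k ⟩
  suc (k ℕ.+ k) ℕ.* c
    ≡⟨ ℕS.solve 2 (λ k c → (ℕS.con 1 ℕS.:+ (k ℕS.:+ k)) ℕS.:* c ℕS.:= (ℕS.con 1 ℕS.:+ k) ℕS.:* c ℕS.:+ k ℕS.:* c) refl k c ⟩
  suc k ℕ.* c ℕ.+ k ℕ.* c       ∎)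
  where
  c = (k ℕ.+ k) C k
  d = (k ℕ.+ k) C suc k

catalan+[2k]C[k+1]≡[2k]Ck : ∀ k → catalan k ℕ.+ (k ℕ.+ k) C suc k ≡ (k ℕ.+ k) C k
catalan+[2k]C[k+1]≡[2k]Ck k = begin
  catalan k ℕ.+ d                  ≡⟨ cong (λ z → (z C k) ℕ./ suc k ℕ.+ d) (cong (k ℕ.+_) (ℕₚ.+-identityʳ k)) ⟩
  c ℕ./ suc k ℕ.+ d                ≡⟨ cong (λ z → z ℕ./ suc k ℕ.+ d) c≡ ⟩
  (c ∸ d) ℕ.* suc k ℕ./ suc k ℕ.+ d ≡⟨ cong (ℕ._+ d) (m*n/n≡m (c ∸ d) (suc k)) ⟩
  c ∸ d ℕ.+ d                      ≡⟨ ℕₚ.m∸n+n≡m d≤c ⟩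
  c                                ∎
  where
  c = (k ℕ.+ k) C k
  d = (k ℕ.+ k) C suc k
  kc≡ = [k+1]*[2k]C[k+1]≡k*[2k]Ck k
  d≤c : d ≤ c
  d≤c = ℕₚ.*-cancelˡ-≤ (suc k) (subst (ℕ._≤ suc k ℕ.* c) (sym kc≡) (ℕₚ.*-monoˡ-≤ c (ℕₚ.n≤1+n k)))
  c≡ : c ≡ (c ∸ d) ℕ.* suc k
  c≡ = begin
    c                            ≡⟨ sym (ℕₚ.m+n∸n≡m c (k ℕ.* c)) ⟩
    suc k ℕ.* c ∸ k ℕ.* c         ≡⟨ cong (suc k ℕ.* c ∸_) (sym kc≡) ⟩
    suc k ℕ.* c ∸ suc k ℕ.* d     ≡⟨ sym (ℕₚ.*-distribˡ-∸ (suc k) c d) ⟩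
    suc k ℕ.* (c ∸ d)             ≡⟨ ℕₚ.*-comm (suc k) (c ∸ d) ⟩
    (c ∸ d) ℕ.* suc k             ∎

ψ≡T₁ : ∀ k → ψ k ≡ T 1ℚ k 0
ψ≡T₁ k = +-cancelʳ (ℕ→ℚ ((k ℕ.+ k) C suc k)) (ψ k) (T 1ℚ k 0) (begin
  ψ k + ℕ→ℚ ((k ℕ.+ k) C suc k)        ≡⟨ sym (ℕ→ℚ-+ (catalan k) _) ⟩
  ℕ→ℚ (catalan k ℕ.+ (k ℕ.+ k) C suc k) ≡⟨ cong ℕ→ℚ (catalan+[2k]C[k+1]≡[2k]Ck k) ⟩
  ℕ→ℚ ((k ℕ.+ k) C k)                  ≡⟨ sym (ballot k 0) ⟩
  T 1ℚ k 0 + ℕ→ℚ ((k ℕ.+ k) C suc k)   ∎)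

convolution-tail≡0 : ∀ (D : ℕ → ℚ) → (∀ k → D (suc (suc k)) ≡ 0ℚ) →
  ∀ f n qs → sumℚ (zipWith _*_ (map (λ k → D (suc k)) (applyUpTo (λ i → suc (f i)) n)) qs) ≡ 0ℚ
convolution-tail≡0 D D≡0 f zero    qs       = refl
convolution-tail≡0 D D≡0 f (suc n) []       = refl
convolution-tail≡0 D D≡0 f (suc n) (q ∷ qs) = begin
  D (suc (suc (f 0))) * q + sumℚ (zipWith _*_ (map (λ k → D (suc k)) (applyUpTo (λ i → suc (f (suc i))) n)) qs)
    ≡⟨ cong₂ _+_ (trans (cong (_* q) (D≡0 (f 0))) (ℚₚ.*-zeroˡ q)) (convolution-tail≡0 D D≡0 (λ i → f (suc i)) n qs) ⟩
  0ℚ ∎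

convolution-degree≤1 : ∀ (D : ℕ → ℚ) → (∀ k → D (suc (suc k)) ≡ 0ℚ) →
  ∀ n qs → sumℚ (zipWith _*_ (map (λ k → D (suc k)) (upTo (suc n))) qs) ≡ D 1 * headℚ qs
convolution-degree≤1 D D≡0 n []       = sym (ℚₚ.*-zeroʳ (D 1))
convolution-degree≤1 D D≡0 n (q ∷ qs) = trans (cong (D 1 * q +_) (convolution-tail≡0 D D≡0 (λ i → i) n qs)) (ℚₚ.+-identityʳ _)

*-1/-cancelʳ : ∀ a d .{{_ : NonZero d}} → a * d * 1/ d ≡ a
*-1/-cancelʳ a d = trans (ℚₚ.*-assoc a d (1/ d)) (trans (cong (a *_) (ℚₚ.*-inverseʳ d)) (ℚₚ.*-identityʳ a))

seriesDiv-unique : ∀ (N D : ℕ → ℚ) .{{_ : NonZero (D 0)}} → (∀ k → D (suc (suc k)) ≡ 0ℚ) → (a : ℕ → ℚ) →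
  a 0 * D 0 ≡ N 0 → (∀ n → a (suc n) * D 0 + D 1 * a n ≡ N (suc n)) → ∀ n → a n ≡ seriesDiv N D n
seriesDiv-unique N D D≡0 a a₀ aₛ zero    = trans (sym (*-1/-cancelʳ (a 0) (D 0))) (cong (_* 1/ D 0) a₀)
seriesDiv-unique N D D≡0 a a₀ aₛ (suc n) = begin
  a (suc n)
    ≡⟨ sym (*-1/-cancelʳ (a (suc n)) (D 0)) ⟩
  a (suc n) * D 0 * 1/ D 0
    ≡⟨ cong (_* 1/ D 0) (solve 2 (λ u v → u := u :+ v :- v) refl (a (suc n) * D 0) (D 1 * a n)) ⟩
  (a (suc n) * D 0 + D 1 * a n - D 1 * a n) * 1/ D 0
    ≡⟨ cong₂ (λ u v → (u - D 1 * v) * 1/ D 0) (aₛ n) (seriesDiv-unique N D D≡0 a a₀ aₛ n) ⟩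
  (N (suc n) - D 1 * seriesDiv N D n) * 1/ D 0
    ≡⟨ cong (λ u → (N (suc n) - u) * 1/ D 0) (sym (convolution-degree≤1 D D≡0 n (divRev N D n))) ⟩
  seriesDiv N D (suc n) ∎

T≡seriesDiv : ∀ x .{{_ : NonZero (denom x 0)}} n → T x n 0 ≡ seriesDiv (numer x) (denom x) n
T≡seriesDiv x = seriesDiv-unique (numer x) (denom x) (λ _ → refl) (λ n → T x n 0)
  (solve 1 (λ x → con 1ℚ :* (con (ℕ→ℚ 2) :- x) := con 1ℚ :- x :+ con 1ℚ) refl x)
  (λ n → begin
    T x (suc n) 0 * (ℕ→ℚ 2 - x) + (x - 1ℚ) * (x - 1ℚ) * T x n 0
      ≡⟨ cong (_+ (x - 1ℚ) * (x - 1ℚ) * T x n 0) (ℚₚ.*-comm (T x (suc n) 0) _) ⟩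
    (ℕ→ℚ 2 - x) * T x (suc n) 0 + (x - 1ℚ) * (x - 1ℚ) * T x n 0
      ≡⟨ T-kernel-equation x n ⟩
    T 1ℚ (suc n) 0
      ≡⟨ sym (ψ≡T₁ (suc n)) ⟩
    ψ (suc n)                                                   ∎)

Distinct : List ℕ → Set
Distinct []      = ⊤
Distinct (a ∷ v) = a ∉ v × Distinct v

countIn : List ℕ → ℕ → ℕ → ℕ
countIn v lo zero    = 0
countIn v lo (suc m) with lo ∈? v
... | yes _ = suc (countIn v (suc lo) m)
... | no  _ = countIn v (suc lo) m

countIn≤ : ∀ v lo m → countIn v lo m ≤ m
countIn≤ v lo zero    = z≤n
countIn≤ v lo (suc m) with lo ∈? v
... | yes _ = s≤s (countIn≤ v (suc lo) m)
... | no  _ = ℕₚ.m≤n⇒m≤1+n (countIn≤ v (suc lo) m)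

countIn-+ : ∀ v lo a b → countIn v lo (a ℕ.+ b) ≡ countIn v lo a ℕ.+ countIn v (a ℕ.+ lo) b
countIn-+ v lo zero    b = refl
countIn-+ v lo (suc a) b with lo ∈? v
... | yes _ = cong suc (trans (countIn-+ v (suc lo) a b) (cong (λ z → countIn v (suc lo) a ℕ.+ countIn v z b) (ℕₚ.+-suc a lo)))
... | no  _ = trans (countIn-+ v (suc lo) a b) (cong (λ z → countIn v (suc lo) a ℕ.+ countIn v z b) (ℕₚ.+-suc a lo))

countIn-full : ∀ v lo m → (∀ {t} → t < m → t ℕ.+ lo ∈ v) → countIn v lo m ≡ m
countIn-full v lo zero    all∈ = refl
countIn-full v lo (suc m) all∈ with lo ∈? v
... | yes _   = cong suc (countIn-full v (suc lo) m (λ t<m → subst (_∈ v) (sym (ℕₚ.+-suc _ lo)) (all∈ (s≤s t<m))))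
... | no  lo∉ = ⊥-elim (lo∉ (all∈ {0} (s≤s z≤n)))

countIn<-of-∉ : ∀ v lo m {t} → t < m → t ℕ.+ lo ∉ v → countIn v lo m < m
countIn<-of-∉ v lo (suc m) {t} t<m t∉ with lo ∈? v | t
... | no  _   | _     = s≤s (countIn≤ v (suc lo) m)
... | yes lo∈ | zero  = ⊥-elim (t∉ lo∈)
... | yes _   | suc t = s≤s (countIn<-of-∉ v (suc lo) m (ℕₚ.≤-pred t<m) (λ t∈ → t∉ (subst (_∈ v) (ℕₚ.+-suc t lo) t∈)))

∉-of-countIn< : ∀ v lo m → countIn v lo m < m → ∃ λ t → t < m × t ℕ.+ lo ∉ v
∉-of-countIn< v lo (suc m) count< with lo ∈? v
... | no  lo∉ = 0 , s≤s z≤n , lo∉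
... | yes _   with ∉-of-countIn< v (suc lo) m (ℕₚ.≤-pred count<)
...   | t , t<m , t∉ = suc t , s≤s t<m , (λ t∈ → t∉ (subst (_∈ v) (sym (ℕₚ.+-suc t lo)) t∈))

countIn-positive : ∀ v lo m → lo ∈ v → 0 < m → 0 < countIn v lo m
countIn-positive v lo (suc m) lo∈ _ with lo ∈? v
... | yes _   = s≤s z≤n
... | no  lo∉ = ⊥-elim (lo∉ lo∈)

countIn-suc-∈ : ∀ v lo m → lo ∈ v → countIn v lo (suc m) ≡ suc (countIn v (suc lo) m)
countIn-suc-∈ v lo m lo∈ with lo ∈? v
... | yes _   = refl
... | no  lo∉ = ⊥-elim (lo∉ lo∈)

countIn-suc-∉ : ∀ v lo m → lo ∉ v → countIn v lo (suc m) ≡ countIn v (suc lo) m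
countIn-suc-∉ v lo m lo∉ with lo ∈? v
... | yes lo∈ = ⊥-elim (lo∉ lo∈)
... | no  _   = refl

countIn-∷-below : ∀ a v lo m → a < lo → countIn (a ∷ v) lo m ≡ countIn v lo m
countIn-∷-below a v lo zero    a<lo = refl
countIn-∷-below a v lo (suc m) a<lo = case lo ∈? v of λ where
  (yes lo∈) → begin
    countIn (a ∷ v) lo (suc m)       ≡⟨ countIn-suc-∈ (a ∷ v) lo m (there lo∈) ⟩
    suc (countIn (a ∷ v) (suc lo) m) ≡⟨ cong suc (countIn-∷-below a v (suc lo) m (ℕₚ.m<n⇒m<1+n a<lo)) ⟩
    suc (countIn v (suc lo) m)       ≡⟨ countIn-suc-∈ v lo m lo∈ ⟨
    countIn v lo (suc m)             ∎
  (no lo∉) → begin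
    countIn (a ∷ v) lo (suc m)
      ≡⟨ countIn-suc-∉ (a ∷ v) lo m (λ { (here refl) → ℕₚ.<-irrefl refl a<lo ; (there lo∈) → lo∉ lo∈ }) ⟩
    countIn (a ∷ v) (suc lo) m
      ≡⟨ countIn-∷-below a v (suc lo) m (ℕₚ.m<n⇒m<1+n a<lo) ⟩
    countIn v (suc lo) m
      ≡⟨ countIn-suc-∉ v lo m lo∉ ⟨
    countIn v lo (suc m) ∎

countIn-∷-here : ∀ a v m → a ∉ v → countIn (a ∷ v) a (suc m) ≡ suc (countIn v a (suc m))
countIn-∷-here a v m a∉ = begin
  countIn (a ∷ v) a (suc m)       ≡⟨ countIn-suc-∈ (a ∷ v) a m (here refl) ⟩
  suc (countIn (a ∷ v) (suc a) m) ≡⟨ cong suc (countIn-∷-below a v (suc a) m (ℕₚ.n<1+n a)) ⟩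
  suc (countIn v (suc a) m)       ≡⟨ cong suc (countIn-suc-∉ v a m a∉) ⟨
  suc (countIn v a (suc m))       ∎

countIn-∷ : ∀ a v lo m → a ∉ v → lo ≤ a → a < m ℕ.+ lo → countIn (a ∷ v) lo m ≡ suc (countIn v lo m)
countIn-∷-after : ∀ a v lo m → a ∉ v → lo < a → a < suc m ℕ.+ lo → countIn (a ∷ v) lo (suc m) ≡ suc (countIn v lo (suc m))

countIn-∷ a v lo zero    a∉ lo≤a a<m+lo = ⊥-elim (ℕₚ.<⇒≱ a<m+lo lo≤a)
countIn-∷ a v lo (suc m) a∉ lo≤a a<m+lo = case lo ℕₚ.≟ a of λ where
  (yes lo≡a) → subst (λ z → countIn (a ∷ v) z (suc m) ≡ suc (countIn v z (suc m))) (sym lo≡a) (countIn-∷-here a v m a∉)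
  (no lo≢a)  → countIn-∷-after a v lo m a∉ (ℕₚ.≤∧≢⇒< lo≤a lo≢a) a<m+lo

countIn-∷-after a v lo m a∉ lo<a a<m+lo = case lo ∈? v of λ where
    (yes lo∈) → begin
      countIn (a ∷ v) lo (suc m)       ≡⟨ countIn-suc-∈ (a ∷ v) lo m (there lo∈) ⟩
      suc (countIn (a ∷ v) (suc lo) m) ≡⟨ cong suc (countIn-∷ a v (suc lo) m a∉ lo<a a<m+slo) ⟩
      suc (suc (countIn v (suc lo) m)) ≡⟨ cong suc (countIn-suc-∈ v lo m lo∈) ⟨
      suc (countIn v lo (suc m))       ∎
    (no lo∉) → begin
      countIn (a ∷ v) lo (suc m)
        ≡⟨ countIn-suc-∉ (a ∷ v) lo m (λ { (here refl) → ℕₚ.<-irrefl refl lo<a ; (there lo∈) → lo∉ lo∈ }) ⟩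
      countIn (a ∷ v) (suc lo) m
        ≡⟨ countIn-∷ a v (suc lo) m a∉ lo<a a<m+slo ⟩
      suc (countIn v (suc lo) m)
        ≡⟨ cong suc (countIn-suc-∉ v lo m lo∉) ⟨
      suc (countIn v lo (suc m)) ∎
  where
  a<m+slo : a < m ℕ.+ suc lo
  a<m+slo = subst (a <_) (sym (ℕₚ.+-suc m lo)) a<m+lo

countIn-[] : ∀ lo m → countIn [] lo m ≡ 0
countIn-[] lo zero    = refl
countIn-[] lo (suc m) = countIn-[] (suc lo) m

countIn-length : ∀ v lo m → Distinct v → All (λ b → lo ≤ b × b < m ℕ.+ lo) v → countIn v lo m ≡ length v
countIn-length []      lo m _ _ = countIn-[] lo m
countIn-length (a ∷ w) lo m (a∉ , distinct) ((lo≤a , a<) ∷ inside) =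
  trans (countIn-∷ a w lo m a∉ lo≤a a<) (cong suc (countIn-length w lo m distinct inside))

¬T⇒T-not : ∀ {b} → ¬ Bool.T b → Bool.T (not b)
¬T⇒T-not {false} _  = tt
¬T⇒T-not {true}  ¬t = ¬t tt

T-not⇒¬T : ∀ {b} → Bool.T (not b) → ¬ Bool.T b
T-not⇒¬T {false} _ ()

¬all⇒∃¬ : ∀ {A : Set} (p : A → Bool) xs → ¬ Bool.T (all p xs) → ∃ λ y → ¬ Bool.T (p y)
¬all⇒∃¬ p xs ¬all = satisfied (¬All⇒Any¬ (T? ∘ p) xs (¬all ∘ all⁻ p))

injective⇒surjective : ∀ {m} (f : Fin m → Fin m) → (∀ i j → i Fin.< j → f i ≢ f j) → ∀ b → ∃ λ i → f i ≡ b
injective⇒surjective {suc m} f injective b with Finₚ.any? (λ i → f i Finₚ.≟ b)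
... | yes hit  = hit
... | no  miss with Finₚ.pigeonhole (ℕₚ.n<1+n m) (λ i → Fin.punchOut {i = b} {j = f i} (λ b≡ → miss (i , sym b≡)))
... | i , j , i<j , punched≡ =
  ⊥-elim (injective i j i<j (Finₚ.punchOut-injective {i = b} (λ b≡ → miss (i , sym b≡)) (λ b≡ → miss (j , sym b≡)) punched≡))

countᵇ : ∀ {k} → (Fin k → Bool) → ℕ
countᵇ {zero}  q = 0
countᵇ {suc k} q = (if q Fin.zero then 1 else 0) ℕ.+ countᵇ (q ∘ Fin.suc)

countᵇ-cong : ∀ {k} {q q′ : Fin k → Bool} → (∀ i → q i ≡ q′ i) → countᵇ q ≡ countᵇ q′
countᵇ-cong {zero}  q≡q′ = refl
countᵇ-cong {suc k} q≡q′ = cong₂ (λ b c → (if b then 1 else 0) ℕ.+ c) (q≡q′ Fin.zero) (countᵇ-cong (q≡q′ ∘ Fin.suc))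

length-filterᵇ-tabulate : ∀ {A : Set} {k} (q : A → Bool) (g : Fin k → A) → length (filterᵇ q (tabulate g)) ≡ countᵇ (q ∘ g)
length-filterᵇ-tabulate {k = zero}  q g = refl
length-filterᵇ-tabulate {k = suc k} q g with q (g Fin.zero)
... | true  = cong suc (length-filterᵇ-tabulate q (g ∘ Fin.suc))
... | false = length-filterᵇ-tabulate q (g ∘ Fin.suc)

sumℚ-++ : ∀ qs rs → sumℚ (qs ++ rs) ≡ sumℚ qs + sumℚ rs
sumℚ-++ []       rs = sym (ℚₚ.+-identityˡ _)
sumℚ-++ (q ∷ qs) rs = trans (cong (q +_) (sumℚ-++ qs rs)) (sym (ℚₚ.+-assoc q _ _))

sumℚ-concatMap : ∀ {B C : Set} (g : C → ℚ) (K : B → List C) L →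
  sumℚ (map g (concatMap K L)) ≡ sumℚ (map (λ y → sumℚ (map g (K y))) L)
sumℚ-concatMap g K []      = refl
sumℚ-concatMap g K (y ∷ L) = begin
  sumℚ (map g (K y ++ concatMap K L))                        ≡⟨ cong sumℚ (Listₚ.map-++ g (K y) (concatMap K L)) ⟩
  sumℚ (map g (K y) ++ map g (concatMap K L))                ≡⟨ sumℚ-++ (map g (K y)) _ ⟩
  sumℚ (map g (K y)) + sumℚ (map g (concatMap K L))          ≡⟨ cong (sumℚ (map g (K y)) +_) (sumℚ-concatMap g K L) ⟩
  sumℚ (map g (K y)) + sumℚ (map (λ z → sumℚ (map g (K z))) L) ∎

sumℚ-filterᵇ : ∀ {B : Set} (p : B → Bool) (g : B → ℚ) L →
  sumℚ (map g (filterᵇ p L)) ≡ sumℚ (map (λ y → if p y then g y else 0ℚ) L)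
sumℚ-filterᵇ p g []      = refl
sumℚ-filterᵇ p g (y ∷ L) with p y
... | true  = cong (g y +_) (sumℚ-filterᵇ p g L)
... | false = trans (sumℚ-filterᵇ p g L) (sym (ℚₚ.+-identityˡ _))

sumℚ-tabulate : ∀ m (f : ℕ → ℚ) → sumℚ (tabulate {n = m} (f ∘ toℕ)) ≡ ∑< m f
sumℚ-tabulate zero    f = refl
sumℚ-tabulate (suc m) f = trans (cong (f 0 +_) (sumℚ-tabulate m (f ∘ suc))) (sym (∑<-suc m f))

sumℚ-allFin : ∀ m (f : ℕ → ℚ) → sumℚ (map (f ∘ toℕ) (allFin m)) ≡ ∑< m f
sumℚ-allFin m f = trans (cong sumℚ (Listₚ.map-tabulate {n = m} (λ a → a) (f ∘ toℕ))) (sumℚ-tabulate m f)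

module Suffixes (n : ℕ) where

  -- Lists of values below n, read as the right end of a permutation of {0, …, n−1};
  -- the empty suffix has lowest value n, so that every value is a new minimum for it.

  lowest : List ℕ → ℕ
  lowest []      = n
  lowest (a ∷ v) = a ⊓ lowest v

  LargestMissing : List ℕ → ℕ → Set
  LargestMissing v a = a ∉ v × (∀ {b} → b < n → a < b → b ∈ v)

  -- Reading a 321-avoiding permutation from right to left, every entry is either a new minimum
  -- or the largest value not yet used; Admissible v says that v was built in this way.
  Admissible : List ℕ → Set
  Admissible []      = ⊤
  Admissible (a ∷ v) = Admissible v × a < n × (a < lowest v ⊎ LargestMissing v a)

  Has21Below : ℕ → List ℕ → Set
  Has21Below a []      = ⊥
  Has21Below a (b ∷ v) = (b < a × Any (_< b) v) ⊎ Has21Below a v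

  Avoids321 : List ℕ → Set
  Avoids321 []      = ⊤
  Avoids321 (a ∷ v) = ¬ Has21Below a v × Avoids321 v

  largestMissing? : ∀ v a → Dec (LargestMissing v a)
  largestMissing? v a = ¬? (a ∈? v) ×-dec ℕₚ.allUpTo? (λ b → a <? b →-dec b ∈? v) n

  admissible? : ∀ v → Dec (Admissible v)
  admissible? []      = yes tt
  admissible? (a ∷ v) = admissible? v ×-dec (a <? n) ×-dec ((a <? lowest v) ⊎-dec largestMissing? v a)

  lowest≤n : ∀ v → lowest v ≤ n
  lowest≤n []      = ℕₚ.≤-refl
  lowest≤n (a ∷ v) = ℕₚ.≤-trans (ℕₚ.m⊓n≤n a (lowest v)) (lowest≤n v)

  lowest-≤ : ∀ {b} v → b ∈ v → lowest v ≤ b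
  lowest-≤ (a ∷ v) (here refl) = ℕₚ.m⊓n≤m a (lowest v)
  lowest-≤ (a ∷ v) (there b∈v) = ℕₚ.≤-trans (ℕₚ.m⊓n≤n a (lowest v)) (lowest-≤ v b∈v)

  lowest-∈-∷ : ∀ a v → All (_< n) (a ∷ v) → lowest (a ∷ v) ∈ a ∷ v
  lowest-∈-∷ a []      (a<n ∷ []) = here (ℕₚ.m≤n⇒m⊓n≡m (ℕₚ.<⇒≤ a<n))
  lowest-∈-∷ a (b ∷ v) (a<n ∷ bv<n) with ℕₚ.⊓-sel a (lowest (b ∷ v))
  ... | inj₁ a⊓≡a = here a⊓≡a
  ... | inj₂ a⊓≡l = there (subst (_∈ b ∷ v) (sym a⊓≡l) (lowest-∈-∷ b v bv<n))

  lowest-∈ : ∀ v → All (_< n) v → lowest v < n → lowest v ∈ v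
  lowest-∈ []      _   l<n = ⊥-elim (ℕₚ.<-irrefl refl l<n)
  lowest-∈ (a ∷ v) v<n _   = lowest-∈-∷ a v v<n

  lowest-< : ∀ {b} v → Any (_< b) v → lowest v < b
  lowest-< (a ∷ v) (here a<b)  = ℕₚ.≤-<-trans (ℕₚ.m⊓n≤m a (lowest v)) a<b
  lowest-< (a ∷ v) (there any) = ℕₚ.≤-<-trans (ℕₚ.m⊓n≤n a (lowest v)) (lowest-< v any)

  Admissible⇒All<n : ∀ v → Admissible v → All (_< n) v
  Admissible⇒All<n []      _              = []
  Admissible⇒All<n (a ∷ v) (adm , a<n , _) = a<n ∷ Admissible⇒All<n v adm

  Admissible⇒Distinct : ∀ v → Admissible v → Distinct v
  Admissible⇒Distinct []      _                       = tt
  Admissible⇒Distinct (a ∷ v) (adm , _ , inj₁ a<l)    = (λ a∈v → ℕₚ.<⇒≱ a<l (lowest-≤ v a∈v)) , Admissible⇒Distinct v adm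
  Admissible⇒Distinct (a ∷ v) (adm , _ , inj₂ (a∉v , _)) = a∉v , Admissible⇒Distinct v adm

  has21Below⇒∈ : ∀ {a} v → Admissible v → Has21Below a v → a < n → a ∈ v
  has21Below⇒∈ (b ∷ w) (_ , _ , inj₁ b<l)        (inj₁ (b<a , c<b)) a<n = ⊥-elim (ℕₚ.<-asym b<l (lowest-< w c<b))
  has21Below⇒∈ (b ∷ w) (_ , _ , inj₂ (_ , above)) (inj₁ (b<a , _))   a<n = there (above a<n b<a)
  has21Below⇒∈ (b ∷ w) (adm , _ , _)              (inj₂ has21)     a<n = there (has21Below⇒∈ w adm has21 a<n)

  Admissible⇒Avoids321 : ∀ v → Admissible v → Avoids321 v
  Admissible⇒Avoids321 []      _ = tt
  Admissible⇒Avoids321 (a ∷ v) adm@(adm-v , a<n , _) =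
    (λ has21 → proj₁ (Admissible⇒Distinct (a ∷ v) adm) (has21Below⇒∈ v adm-v has21 a<n)) , Admissible⇒Avoids321 v adm-v

  Has21Below-++ : ∀ p {v a} → Has21Below a v → Has21Below a (p ++ v)
  Has21Below-++ []      has21 = has21
  Has21Below-++ (c ∷ p) has21 = inj₂ (Has21Below-++ p has21)

  Avoids321-++ : ∀ p {v b} → Avoids321 (p ++ v) → b ∈ p → ¬ Has21Below b v
  Avoids321-++ (c ∷ p) (no21 , _)   (here refl) has21 = no21 (Has21Below-++ p has21)
  Avoids321-++ (c ∷ p) (_ , avoids) (there b∈p) has21 = Avoids321-++ p avoids b∈p has21

  Distinct-++ʳ : ∀ p {v} → Distinct (p ++ v) → Distinct v
  Distinct-++ʳ []      distinct       = distinct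
  Distinct-++ʳ (c ∷ p) (_ , distinct) = Distinct-++ʳ p distinct

  ≮lowest⇒lowest< : ∀ {a} w → All (_< n) w → a < n → ¬ a < lowest w → a ∉ w → lowest w < a
  ≮lowest⇒lowest< []      _     a<n a≮l _   = ⊥-elim (a≮l a<n)
  ≮lowest⇒lowest< (c ∷ w) w<n   _   a≮l a∉w =
    ℕₚ.≤∧≢⇒< (ℕₚ.≮⇒≥ a≮l) (λ l≡a → a∉w (subst (_∈ c ∷ w) l≡a (lowest-∈-∷ c w w<n)))

  -- In a 321-avoiding arrangement of all values, an entry a that is not a new minimum has a smaller entry c
  -- to its right, so no larger value b may stand to its left: all of them are to its right.
  largestMissing-of-permutation : ∀ p {a w} → Distinct (p ++ a ∷ w) → Avoids321 (p ++ a ∷ w) → (∀ {b} → b < n → b ∈ p ++ a ∷ w) →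
                                   All (_< n) (a ∷ w) → ¬ a < lowest w → LargestMissing w a
  largestMissing-of-permutation p {a} {w} distinct avoids complete (a<n ∷ w<n) a≮l = a∉w , above
    where
    a∉w : a ∉ w
    a∉w = proj₁ (Distinct-++ʳ p distinct)
    l<a : lowest w < a
    l<a = ≮lowest⇒lowest< w w<n a<n a≮l a∉w
    above : ∀ {b} → b < n → a < b → b ∈ w
    above {b} b<n a<b with ∈-++⁻ p (complete b<n)
    ... | inj₁ b∈p          = ⊥-elim (Avoids321-++ p avoids b∈p (inj₁ (a<b , lose (lowest-∈ w w<n (ℕₚ.<-trans l<a a<n)) l<a)))
    ... | inj₂ (here refl)  = ⊥-elim (ℕₚ.<-irrefl refl a<b)
    ... | inj₂ (there b∈w)  = b∈w

  permutation-suffix⇒Admissible : ∀ p v → Distinct (p ++ v) → Avoids321 (p ++ v) → (∀ {b} → b < n → b ∈ p ++ v) →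
                                   All (_< n) v → Admissible v
  permutation-suffix⇒Admissible p []      _        _      _        _              = tt
  permutation-suffix⇒Admissible p (a ∷ w) distinct avoids complete all@(a<n ∷ w<n) =
    permutation-suffix⇒Admissible (p ++ [ a ]) w (subst Distinct p++a∷w≡ distinct) (subst Avoids321 p++a∷w≡ avoids)
      (λ b<n → subst (_ ∈_) p++a∷w≡ (complete b<n)) w<n ,
    a<n ,
    newMin-or-largestMissing
    where
    p++a∷w≡ : p ++ a ∷ w ≡ (p ++ [ a ]) ++ w
    p++a∷w≡ = sym (Listₚ.++-assoc p [ a ] w)
    newMin-or-largestMissing : a < lowest w ⊎ LargestMissing w a
    newMin-or-largestMissing with a <? lowest w
    ... | yes a<l = inj₁ a<l
    ... | no  a≮l = inj₂ (largestMissing-of-permutation p distinct avoids complete all a≮l)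

  countIn-admissible : ∀ v m → Admissible v → m ℕ.+ lowest v ≡ n → countIn v (lowest v) m ≡ length v
  countIn-admissible v m adm m+l≡n = countIn-length v (lowest v) m (Admissible⇒Distinct v adm)
    (All.tabulate (λ b∈v → lowest-≤ v b∈v , subst (_ <_) (sym m+l≡n) (All.lookup (Admissible⇒All<n v adm) b∈v)))

  lowest+length≤n : ∀ v → Admissible v → lowest v ℕ.+ length v ≤ n
  lowest+length≤n v adm =
    subst (λ len → lowest v ℕ.+ len ≤ n) (countIn-admissible v (n ∸ lowest v) adm (ℕₚ.m∸n+n≡m (lowest≤n v)))
          (ℕₚ.≤-trans (ℕₚ.+-monoʳ-≤ (lowest v) (countIn≤ v (lowest v) (n ∸ lowest v)))
                      (ℕₚ.≤-reflexive (ℕₚ.m+[n∸m]≡n (lowest≤n v))))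

  largestMissing-unique : ∀ v {a a′} → LargestMissing v a → LargestMissing v a′ → a < n → a′ < n → a ≡ a′
  largestMissing-unique v {a} {a′} (a∉ , above) (a′∉ , above′) a<n a′<n with ℕₚ.<-cmp a a′
  ... | tri< a<a′ _ _ = ⊥-elim (a′∉ (above a′<n a<a′))
  ... | tri≈ _ a≡a′ _ = a≡a′
  ... | tri> _ _ a′<a = ⊥-elim (a∉ (above′ a<n a′<a))

  largestMissing-below : ∀ v {b} k → k ≤ n → b < k → b ∉ v → (∀ {c} → c < n → k ≤ c → c ∈ v) →
                         ∃ λ a → b ≤ a × a < n × LargestMissing v a
  largestMissing-below v {b} (suc k) sk≤n b<sk b∉ above with k ∈? v
  ... | no  k∉ = k , ℕₚ.≤-pred b<sk , sk≤n , k∉ , above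
  ... | yes k∈ = largestMissing-below v k (ℕₚ.<⇒≤ sk≤n) b<k b∉ above′
    where
    b<k : b < k
    b<k = ℕₚ.≤∧≢⇒< (ℕₚ.≤-pred b<sk) (λ b≡k → b∉ (subst (_∈ v) (sym b≡k) k∈))
    above′ : ∀ {c} → c < n → k ≤ c → c ∈ v
    above′ {c} c<n k≤c with k ℕₚ.≟ c
    ... | yes k≡c = subst (_∈ v) k≡c k∈
    ... | no  k≢c = above c<n (ℕₚ.≤∧≢⇒< k≤c k≢c)

  largestMissing-exists : ∀ v → Admissible v → lowest v ℕ.+ length v < n → ∃ λ a → lowest v < a × a < n × LargestMissing v a
  largestMissing-exists v adm l+len<n with ∉-of-countIn< v (lowest v) (n ∸ lowest v) count<
    where
    count< : countIn v (lowest v) (n ∸ lowest v) < n ∸ lowest v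
    count< = subst (_< n ∸ lowest v) (sym (countIn-admissible v (n ∸ lowest v) adm (ℕₚ.m∸n+n≡m (lowest≤n v))))
               (ℕₚ.+-cancelˡ-< (lowest v) _ _ (subst (lowest v ℕ.+ length v <_) (sym (ℕₚ.m+[n∸m]≡n (lowest≤n v))) l+len<n))
  ... | zero  , _    , l∉ = ⊥-elim (l∉ (lowest-∈ v (Admissible⇒All<n v adm) (ℕₚ.≤-<-trans (ℕₚ.m≤m+n (lowest v) (length v)) l+len<n)))
  ... | suc t , t<n∸l , b∉ with largestMissing-below v n ℕₚ.≤-refl b<n b∉ (λ c<n n≤c → ⊥-elim (ℕₚ.<⇒≱ c<n n≤c))
    where
    b<n : suc t ℕ.+ lowest v < n
    b<n = subst (suc t ℕ.+ lowest v <_) (ℕₚ.m∸n+n≡m (lowest≤n v)) (ℕₚ.+-monoˡ-< (lowest v) t<n∸l)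
  ...   | a , b≤a , a<n , missing = a , ℕₚ.<-≤-trans (s≤s (ℕₚ.m≤n+m (lowest v) t)) b≤a , a<n , missing

  module _ {v a} (adm : Admissible v) (missing : LargestMissing v a) (l<a : lowest v < a) (a<n : a < n) where

    private
      μ = lowest v
      d = a ∸ μ
      r = n ∸ suc a
      d+μ≡a : d ℕ.+ μ ≡ a
      d+μ≡a = ℕₚ.m∸n+n≡m (ℕₚ.<⇒≤ l<a)
      r+sa≡n : r ℕ.+ suc a ≡ n
      r+sa≡n = ℕₚ.m∸n+n≡m a<n
      1+d+r+μ≡n : suc d ℕ.+ r ℕ.+ μ ≡ n
      1+d+r+μ≡n = begin
        suc d ℕ.+ r ℕ.+ μ   ≡⟨ ℕS.solve 3 (λ μ d r → ℕS.con 1 ℕS.:+ d ℕS.:+ r ℕS.:+ μ ℕS.:= r ℕS.:+ (ℕS.con 1 ℕS.:+ (d ℕS.:+ μ))) refl μ d r ⟩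
        r ℕ.+ suc (d ℕ.+ μ) ≡⟨ cong (λ z → r ℕ.+ suc z) d+μ≡a ⟩
        r ℕ.+ suc a         ≡⟨ r+sa≡n ⟩
        n                   ∎
      1+μ+d+r≡n : suc (μ ℕ.+ (d ℕ.+ r)) ≡ n
      1+μ+d+r≡n = trans (ℕS.solve 3 (λ μ d r → ℕS.con 1 ℕS.:+ (μ ℕS.:+ (d ℕS.:+ r)) ℕS.:= ℕS.con 1 ℕS.:+ d ℕS.:+ r ℕS.:+ μ) refl μ d r)
                        1+d+r+μ≡n
      below = countIn v μ (suc d)

      -- Every value above a occurs in v, so v consists of r values above a and `below` values in [μ, a].
      length≡ : length v ≡ below ℕ.+ r
      length≡ = begin
        length v
          ≡⟨ countIn-admissible v (suc d ℕ.+ r) adm 1+d+r+μ≡n ⟨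
        countIn v μ (suc d ℕ.+ r)
          ≡⟨ countIn-+ v μ (suc d) r ⟩
        below ℕ.+ countIn v (suc d ℕ.+ μ) r
          ≡⟨ cong (below ℕ.+_) (countIn-full v (suc d ℕ.+ μ) r above) ⟩
        below ℕ.+ r ∎
        where
        above : ∀ {t} → t < r → t ℕ.+ (suc d ℕ.+ μ) ∈ v
        above {t} t<r = subst (λ z → t ℕ.+ suc z ∈ v) (sym d+μ≡a)
          (proj₂ missing (subst (t ℕ.+ suc a <_) r+sa≡n (ℕₚ.+-monoˡ-< (suc a) t<r)) (ℕₚ.m≤n+m (suc a) t))

      below≤d : below ≤ d
      below≤d = ℕₚ.≤-pred (countIn<-of-∉ v μ (suc d) (ℕₚ.n<1+n d) (λ a∈ → proj₁ missing (subst (_∈ v) d+μ≡a a∈)))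

      0<below : 0 < below
      0<below = countIn-positive v μ (suc d) (lowest-∈ v (Admissible⇒All<n v adm) (ℕₚ.<-trans l<a a<n)) (s≤s z≤n)

    lowest+length<n : lowest v ℕ.+ length v < n
    lowest+length<n = subst₂ (λ len m → μ ℕ.+ len < m) (sym length≡) 1+μ+d+r≡n (s≤s (ℕₚ.+-monoʳ-≤ μ (ℕₚ.+-monoˡ-≤ r below≤d)))

    n≤largestMissing+length : n ≤ a ℕ.+ length v
    n≤largestMissing+length = subst₂ (λ m len → m ≤ a ℕ.+ len)
      (trans (ℕS.solve 2 (λ a r → a ℕS.:+ (ℕS.con 1 ℕS.:+ r) ℕS.:= r ℕS.:+ (ℕS.con 1 ℕS.:+ a)) refl a r) r+sa≡n) (sym length≡)
      (ℕₚ.+-monoʳ-≤ a (ℕₚ.+-monoˡ-≤ r 0<below))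

module Completions (n : ℕ) (x : ℚ) where

  open Suffixes n

  ∑words : ℕ → (List ℕ → ℚ) → ℚ
  ∑words zero    H = H []
  ∑words (suc j) H = ∑words j (λ l → ∑< n (λ i → H (i ∷ l)))

  ∑words-snoc : ∀ j H → ∑words (suc j) H ≡ ∑< n (λ i → ∑words j (λ l → H (l ++ [ i ])))
  ∑words-snoc zero    H = refl
  ∑words-snoc (suc j) H = ∑words-snoc j (λ l → ∑< n (λ i → H (i ∷ l)))

  ∑words-cong : ∀ j {H H′ : List ℕ → ℚ} → (∀ l → H l ≡ H′ l) → ∑words j H ≡ ∑words j H′
  ∑words-cong zero    H≡H′ = H≡H′ []
  ∑words-cong (suc j) H≡H′ = ∑words-cong j (λ l → ∑<-cong n (λ _ → H≡H′ (_ ∷ l)))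

  -- An entry a followed by k further entries stands at position n ∸ suc k of a word of length n.
  fixFactor : ℕ → ℕ → ℚ
  fixFactor a k = if does (suc (a ℕ.+ k) ℕₚ.≟ n) then x else 1ℚ

  fixFactor-fixed : ∀ {a k} → suc (a ℕ.+ k) ≡ n → fixFactor a k ≡ x
  fixFactor-fixed {a} {k} fixed = cong (λ b → if b then x else 1ℚ) (dec-true (suc (a ℕ.+ k) ℕₚ.≟ n) fixed)

  fixFactor-moved : ∀ {a k} → suc (a ℕ.+ k) ≢ n → fixFactor a k ≡ 1ℚ
  fixFactor-moved {a} {k} moved = cong (λ b → if b then x else 1ℚ) (dec-false (suc (a ℕ.+ k) ℕₚ.≟ n) moved)

  suffixWeight : List ℕ → ℚ
  suffixWeight []      = 1ℚ
  suffixWeight (a ∷ v) = fixFactor a (length v) * suffixWeight v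

  whenAdmissible : List ℕ → ℚ → ℚ
  whenAdmissible v r with admissible? v
  ... | yes _ = r
  ... | no  _ = 0ℚ

  whenAdmissible-yes : ∀ v {r} → Admissible v → whenAdmissible v r ≡ r
  whenAdmissible-yes v adm with admissible? v
  ... | yes _    = refl
  ... | no  ¬adm = ⊥-elim (¬adm adm)

  whenAdmissible-no : ∀ v {r} → ¬ Admissible v → whenAdmissible v r ≡ 0ℚ
  whenAdmissible-no v ¬adm with admissible? v
  ... | yes adm = ⊥-elim (¬adm adm)
  ... | no  _   = refl

  whenAdmissible-cong : ∀ v {r r′} → (Admissible v → r ≡ r′) → whenAdmissible v r ≡ whenAdmissible v r′
  whenAdmissible-cong v r≡r′ with admissible? v
  ... | yes adm = r≡r′ adm
  ... | no  _   = refl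

  score : List ℕ → ℚ
  score l = whenAdmissible l (suffixWeight l)

  height : List ℕ → ℕ
  height v = n ∸ (lowest v ℕ.+ length v)

  child : ℕ → List ℕ → ℕ → ℚ
  child j v i = whenAdmissible (i ∷ v) (suffixWeight (i ∷ v) * T x j (height (i ∷ v)))

  largestMissing-of-child : ∀ v {i} → Admissible v → lowest v ≤ i → Admissible (i ∷ v) → lowest v < i × LargestMissing v i
  largestMissing-of-child v adm l≤i (_ , i<n , inj₁ i<l)     = ⊥-elim (ℕₚ.<⇒≱ i<l l≤i)
  largestMissing-of-child v adm l≤i (_ , i<n , inj₂ missing) =
    ℕₚ.≤∧≢⇒< l≤i (λ l≡i → proj₁ missing (subst (_∈ v) l≡i (lowest-∈ v (Admissible⇒All<n v adm) (subst (_< n) (sym l≡i) i<n))))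
    , missing

  -- The admissible children of v are its new minima i < lowest v and, if a value above lowest v is
  -- missing, the largest missing one: summing over them is the recurrence T-suc.
  module _ (j : ℕ) (v : List ℕ) (j+len≡n : j ℕ.+ suc (length v) ≡ n) (adm : Admissible v) where

    private
      k = length v
      μ = lowest v

    newMin-child : ∀ {i} → i < μ → child j v i ≡ suffixWeight v * newMin x j i
    newMin-child {i} i<μ = begin
      child j v i
        ≡⟨ whenAdmissible-yes (i ∷ v) (adm , i<n , inj₁ i<μ) ⟩
      fixFactor i k * suffixWeight v * T x j (n ∸ (i ⊓ μ ℕ.+ suc k))
        ≡⟨ cong₂ (λ a h → a * suffixWeight v * T x j h) fixFactor≡ height≡ ⟩
      fixWeight x (j ∸ i) * suffixWeight v * T x j (j ∸ i)
        ≡⟨ solve 3 (λ a b c → a :* b :* c := b :* (a :* c)) refl (fixWeight x (j ∸ i)) (suffixWeight v) (T x j (j ∸ i)) ⟩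
      suffixWeight v * newMin x j i ∎
      where
      i<n : i < n
      i<n = ℕₚ.<-≤-trans i<μ (lowest≤n v)
      i≤j : i ≤ j
      i≤j = ℕₚ.≤-pred (ℕₚ.<-≤-trans i<μ (ℕₚ.+-cancelʳ-≤ k μ (suc j)
              (subst (μ ℕ.+ k ≤_) (trans (sym j+len≡n) (ℕₚ.+-suc j k)) (lowest+length≤n v adm))))
      fixFactor≡ : fixFactor i k ≡ fixWeight x (j ∸ i)
      fixFactor≡ with ℕₚ.m≤n⇒m<n∨m≡n i≤j
      ... | inj₂ refl = trans (fixFactor-fixed {i} {k} (trans (sym (ℕₚ.+-suc i k)) j+len≡n)) (cong (fixWeight x) (sym (ℕₚ.n∸n≡0 i)))
      ... | inj₁ i<j  = trans (fixFactor-moved {i} {k} (λ fixed → ℕₚ.<-irrefl (trans fixed (sym j+len≡n))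
                                (subst (suc (i ℕ.+ k) <_) (sym (ℕₚ.+-suc j k)) (s≤s (ℕₚ.+-monoˡ-< k i<j)))))
                              (cong (fixWeight x) (sym (ℕₚ.+-∸-assoc 1 i<j)))
      height≡ : n ∸ (i ⊓ μ ℕ.+ suc k) ≡ j ∸ i
      height≡ = begin
        n ∸ (i ⊓ μ ℕ.+ suc k)
          ≡⟨ cong₂ (λ a b → a ∸ (b ℕ.+ suc k)) (sym j+len≡n) (ℕₚ.m≤n⇒m⊓n≡m (ℕₚ.<⇒≤ i<μ)) ⟩
        j ℕ.+ suc k ∸ (i ℕ.+ suc k)
          ≡⟨ cong₂ _∸_ (ℕₚ.+-comm j (suc k)) (ℕₚ.+-comm i (suc k)) ⟩
        suc k ℕ.+ j ∸ (suc k ℕ.+ i)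
          ≡⟨ ℕₚ.[m+n]∸[m+o]≡n∸o (suc k) j i ⟩
        j ∸ i ∎

    largestMissing-child : ∀ {a} → μ < a → a < n → LargestMissing v a → child j v a ≡ suffixWeight v * T↓ x j (height v)
    largestMissing-child {a} μ<a a<n missing = begin
      child j v a
        ≡⟨ whenAdmissible-yes (a ∷ v) (adm , a<n , inj₂ missing) ⟩
      fixFactor a k * suffixWeight v * T x j (n ∸ (a ⊓ μ ℕ.+ suc k))
        ≡⟨ cong₂ (λ c m → c * suffixWeight v * T x j (n ∸ (m ℕ.+ suc k)))
                 (fixFactor-moved {a} {k} (λ fixed → ℕₚ.<-irrefl (sym fixed) (s≤s n≤a+k))) (ℕₚ.m≥n⇒m⊓n≡n (ℕₚ.<⇒≤ μ<a)) ⟩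
      1ℚ * suffixWeight v * T x j (n ∸ (μ ℕ.+ suc k))
        ≡⟨ cong₂ _*_ (ℚₚ.*-identityˡ (suffixWeight v)) (cong (T↓ x j) height≡) ⟩
      suffixWeight v * T↓ x j (height v) ∎
      where
      n≤a+k = n≤largestMissing+length adm missing μ<a a<n
      height≡ : suc (n ∸ (μ ℕ.+ suc k)) ≡ height v
      height≡ = begin
        suc (n ∸ (μ ℕ.+ suc k)) ≡⟨ cong (λ m → suc (n ∸ m)) (ℕₚ.+-suc μ k) ⟩
        suc (n ∸ suc (μ ℕ.+ k)) ≡⟨ ℕₚ.+-∸-assoc 1 (lowest+length<n adm missing μ<a a<n) ⟨
        n ∸ (μ ℕ.+ k)           ∎

    suc-j∸height≡lowest : suc j ∸ height v ≡ μ
    suc-j∸height≡lowest = begin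
      suc j ∸ height v              ≡⟨ cong (_∸ height v) height+μ≡ ⟨
      height v ℕ.+ μ ∸ height v     ≡⟨ ℕₚ.m+n∸m≡n (height v) μ ⟩
      μ                             ∎
      where
      height+μ≡ : height v ℕ.+ μ ≡ suc j
      height+μ≡ = ℕₚ.+-cancelʳ-≡ k _ _ (begin
        height v ℕ.+ μ ℕ.+ k   ≡⟨ ℕₚ.+-assoc (height v) μ k ⟩
        height v ℕ.+ (μ ℕ.+ k) ≡⟨ ℕₚ.m∸n+n≡m (lowest+length≤n v adm) ⟩
        n                      ≡⟨ trans (sym j+len≡n) (ℕₚ.+-suc j k) ⟩
        suc j ℕ.+ k            ∎)

    ∑-newMin-children : ∑< μ (child j v) ≡ suffixWeight v * ∑< μ (newMin x j)
    ∑-newMin-children = trans (∑<-cong μ newMin-child) (∑<-distribˡ μ (suffixWeight v) (newMin x j))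

    ∑-other-children : ∑< (n ∸ μ) (λ t → child j v (μ ℕ.+ t)) ≡ suffixWeight v * T↓ x j (height v)
    ∑-other-children with μ ℕ.+ k <? n
    ... | no μ+k≮n = begin
      ∑< (n ∸ μ) (λ t → child j v (μ ℕ.+ t))
        ≡⟨ ∑<-≡0 (n ∸ μ) (λ {t} _ → whenAdmissible-no (μ ℕ.+ t ∷ v) (no-child t)) ⟩
      0ℚ
        ≡⟨ ℚₚ.*-zeroʳ (suffixWeight v) ⟨
      suffixWeight v * 0ℚ
        ≡⟨ cong (λ h → suffixWeight v * T↓ x j h) (ℕₚ.m≤n⇒m∸n≡0 (ℕₚ.≮⇒≥ μ+k≮n)) ⟨
      suffixWeight v * T↓ x j (height v) ∎
      where
      no-child : ∀ t → ¬ Admissible (μ ℕ.+ t ∷ v)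
      no-child t adm-child with largestMissing-of-child v adm (ℕₚ.m≤m+n μ t) adm-child
      ... | μ<μ+t , missing = μ+k≮n (lowest+length<n adm missing μ<μ+t (proj₁ (proj₂ adm-child)))
    ... | yes μ+k<n with largestMissing-exists v adm μ+k<n
    ... | a , μ<a , a<n , missing = begin
      ∑< (n ∸ μ) (λ t → child j v (μ ℕ.+ t))     ≡⟨ ∑<-single (n ∸ μ) (ℕₚ.∸-monoˡ-< a<n (ℕₚ.<⇒≤ μ<a)) only-child ⟩
      child j v (μ ℕ.+ (a ∸ μ))                  ≡⟨ cong (child j v) (ℕₚ.m+[n∸m]≡n (ℕₚ.<⇒≤ μ<a)) ⟩
      child j v a                                ≡⟨ largestMissing-child μ<a a<n missing ⟩
      suffixWeight v * T↓ x j (height v)         ∎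
      where
      only-child : ∀ {t} → t < n ∸ μ → t ≢ a ∸ μ → child j v (μ ℕ.+ t) ≡ 0ℚ
      only-child {t} _ t≢ = whenAdmissible-no (μ ℕ.+ t ∷ v) λ adm-child →
        let μ+t≡a = largestMissing-unique v (proj₂ (largestMissing-of-child v adm (ℕₚ.m≤m+n μ t) adm-child)) missing
                                              (proj₁ (proj₂ adm-child)) a<n
        in t≢ (ℕₚ.+-cancelˡ-≡ μ _ _ (trans μ+t≡a (sym (ℕₚ.m+[n∸m]≡n (ℕₚ.<⇒≤ μ<a)))))

    ∑-children : ∑< n (child j v) ≡ suffixWeight v * T x (suc j) (height v)
    ∑-children = begin
      ∑< n (child j v)
        ≡⟨ cong (λ m → ∑< m (child j v)) (ℕₚ.m+[n∸m]≡n (lowest≤n v)) ⟨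
      ∑< (μ ℕ.+ (n ∸ μ)) (child j v)
        ≡⟨ ∑<-+ μ (n ∸ μ) (child j v) ⟩
      ∑< μ (child j v) + ∑< (n ∸ μ) (λ t → child j v (μ ℕ.+ t))
        ≡⟨ cong₂ _+_ ∑-newMin-children ∑-other-children ⟩
      suffixWeight v * ∑< μ (newMin x j) + suffixWeight v * T↓ x j (height v)
        ≡⟨ ℚₚ.*-distribˡ-+ (suffixWeight v) _ _ ⟨
      suffixWeight v * (∑< μ (newMin x j) + T↓ x j (height v))
        ≡⟨ cong (λ m → suffixWeight v * (∑< m (newMin x j) + T↓ x j (height v))) suc-j∸height≡lowest ⟨
      suffixWeight v * (∑< (suc j ∸ height v) (newMin x j) + T↓ x j (height v))
        ≡⟨ cong (suffixWeight v *_) (T-suc x j (height v)) ⟨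
      suffixWeight v * T x (suc j) (height v) ∎

  ∑-children≡ : ∀ j v → j ℕ.+ suc (length v) ≡ n → ∑< n (child j v) ≡ whenAdmissible v (suffixWeight v * T x (suc j) (height v))
  ∑-children≡ j v j+len≡n = case admissible? v of λ where
    (yes adm)  → trans (∑-children j v j+len≡n adm) (sym (whenAdmissible-yes v adm))
    (no  ¬adm) → trans (∑<-≡0 n (λ _ → whenAdmissible-no (_ ∷ v) (λ adm → ¬adm (proj₁ adm)))) (sym (whenAdmissible-no v ¬adm))

  ∑-completions : ∀ j v → j ℕ.+ length v ≡ n → ∑words j (λ l → score (l ++ v)) ≡ whenAdmissible v (suffixWeight v * T x j (height v))
  ∑-completions zero    v len≡n = whenAdmissible-cong v λ _ → begin
    suffixWeight v
      ≡⟨ ℚₚ.*-identityʳ (suffixWeight v) ⟨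
    suffixWeight v * T x 0 0
      ≡⟨ cong (λ h → suffixWeight v * T x 0 h) height≡0 ⟨
    suffixWeight v * T x 0 (height v) ∎
    where
    height≡0 : height v ≡ 0
    height≡0 = ℕₚ.m≤n⇒m∸n≡0 (subst (_≤ lowest v ℕ.+ length v) len≡n (ℕₚ.m≤n+m (length v) (lowest v)))
  ∑-completions (suc j) v len≡n = begin
    ∑words (suc j) (λ l → score (l ++ v))
      ≡⟨ ∑words-snoc j (λ l → score (l ++ v)) ⟩
    ∑< n (λ i → ∑words j (λ l → score ((l ++ [ i ]) ++ v)))
      ≡⟨ ∑<-cong n (λ {i} _ → trans (∑words-cong j (λ l → cong score (Listₚ.++-assoc l [ i ] v))) (∑-completions j (i ∷ v) j+len≡n)) ⟩
    ∑< n (child j v)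
      ≡⟨ ∑-children≡ j v j+len≡n ⟩
    whenAdmissible v (suffixWeight v * T x (suc j) (height v)) ∎
    where
    j+len≡n : j ℕ.+ suc (length v) ≡ n
    j+len≡n = trans (ℕₚ.+-suc j (length v)) len≡n

  ∑words-score≡T : ∑words n score ≡ T x n 0
  ∑words-score≡T = begin
    ∑words n score                     ≡⟨ ∑words-cong n (λ l → cong score (Listₚ.++-identityʳ l)) ⟨
    ∑words n (λ l → score (l ++ []))   ≡⟨ ∑-completions n [] (ℕₚ.+-identityʳ n) ⟩
    1ℚ * T x n (n ∸ (n ℕ.+ 0))         ≡⟨ ℚₚ.*-identityˡ _ ⟩
    T x n (n ∸ (n ℕ.+ 0))              ≡⟨ cong (λ m → T x n (n ∸ m)) (ℕₚ.+-identityʳ n) ⟩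
    T x n (n ∸ n)                      ≡⟨ cong (T x n) (ℕₚ.n∸n≡0 n) ⟩
    T x n 0                            ∎

module Permutations (n : ℕ) (x : ℚ) where

  open Suffixes n
  open Completions n x

  values : ∀ {k} → Vec (Fin n) k → List ℕ
  values []      = []
  values (a ∷ v) = toℕ a ∷ values v

  length-values : ∀ {k} (v : Vec (Fin n) k) → length (values v) ≡ k
  length-values []      = refl
  length-values (a ∷ v) = cong suc (length-values v)

  values<n : ∀ {k} (v : Vec (Fin n) k) → All (_< n) (values v)
  values<n []      = []
  values<n (a ∷ v) = Finₚ.toℕ<n a ∷ values<n v

  lookup-∈-values : ∀ {k} (v : Vec (Fin n) k) i → toℕ (lookup v i) ∈ values v
  lookup-∈-values (a ∷ v) Fin.zero    = here refl
  lookup-∈-values (a ∷ v) (Fin.suc i) = there (lookup-∈-values v i)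

  Any-values⁺ : ∀ {k} (v : Vec (Fin n) k) {P : ℕ → Set} i → P (toℕ (lookup v i)) → Any P (values v)
  Any-values⁺ (a ∷ v) Fin.zero    p = here p
  Any-values⁺ (a ∷ v) (Fin.suc i) p = there (Any-values⁺ v i p)

  Any-values⁻ : ∀ {k} (v : Vec (Fin n) k) {P : ℕ → Set} → Any P (values v) → ∃ λ i → P (toℕ (lookup v i))
  Any-values⁻ (a ∷ v) (here p)  = Fin.zero , p
  Any-values⁻ (a ∷ v) (there q) with Any-values⁻ v q
  ... | i , p = Fin.suc i , p

  DistinctEntries : ∀ {k} → Vec (Fin n) k → Set
  DistinctEntries {k} v = ∀ (i j : Fin k) → i Fin.< j → lookup v i ≢ lookup v j

  No321 : ∀ {k} → Vec (Fin n) k → Set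
  No321 {k} v = ∀ (i j l : Fin k) → i Fin.< j → j Fin.< l → lookup v j Fin.< lookup v i → lookup v l Fin.< lookup v j → ⊥

  DistinctEntries⇒Distinct : ∀ {k} (v : Vec (Fin n) k) → DistinctEntries v → Distinct (values v)
  DistinctEntries⇒Distinct []      _        = tt
  DistinctEntries⇒Distinct (a ∷ w) distinct =
    (λ a∈ → let j , a≡ = Any-values⁻ w a∈ in distinct Fin.zero (Fin.suc j) (s≤s z≤n) (Finₚ.toℕ-injective a≡)) ,
    DistinctEntries⇒Distinct w (λ i j i<j → distinct (Fin.suc i) (Fin.suc j) (s≤s i<j))

  Distinct⇒DistinctEntries : ∀ {k} (v : Vec (Fin n) k) → Distinct (values v) → DistinctEntries v
  Distinct⇒DistinctEntries (a ∷ w) (a∉ , _)       Fin.zero    (Fin.suc j) _         a≡ =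
    a∉ (subst (λ b → toℕ b ∈ values w) (sym a≡) (lookup-∈-values w j))
  Distinct⇒DistinctEntries (a ∷ w) (_ , distinct) (Fin.suc i) (Fin.suc j) (s≤s i<j) = Distinct⇒DistinctEntries w distinct i j i<j

  Has21Below-values⁻ : ∀ {k} (w : Vec (Fin n) k) {c} → Has21Below c (values w) →
    ∃ λ j → ∃ λ l → j Fin.< l × toℕ (lookup w j) < c × toℕ (lookup w l) < toℕ (lookup w j)
  Has21Below-values⁻ (b ∷ w) (inj₁ (b<c , smaller)) with Any-values⁻ w smaller
  ... | l , l<b = Fin.zero , Fin.suc l , s≤s z≤n , b<c , l<b
  Has21Below-values⁻ (b ∷ w) (inj₂ has21) with Has21Below-values⁻ w has21
  ... | j , l , j<l , j<c , l<j = Fin.suc j , Fin.suc l , s≤s j<l , j<c , l<j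

  Has21Below-values⁺ : ∀ {k} (w : Vec (Fin n) k) {c} j l → j Fin.< l → toℕ (lookup w j) < c → toℕ (lookup w l) < toℕ (lookup w j) →
    Has21Below c (values w)
  Has21Below-values⁺ (b ∷ w) Fin.zero    (Fin.suc l) _         j<c l<j = inj₁ (j<c , Any-values⁺ w l l<j)
  Has21Below-values⁺ (b ∷ w) (Fin.suc j) (Fin.suc l) (s≤s j<l) j<c l<j = inj₂ (Has21Below-values⁺ w j l j<l j<c l<j)

  No321⇒Avoids321 : ∀ {k} (v : Vec (Fin n) k) → No321 v → Avoids321 (values v)
  No321⇒Avoids321 []      _     = tt
  No321⇒Avoids321 (a ∷ w) no321 =
    (λ has21 → let j , l , j<l , j<a , l<j = Has21Below-values⁻ w has21 in no321 Fin.zero (Fin.suc j) (Fin.suc l) (s≤s z≤n) (s≤s j<l) j<a l<j) ,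
    No321⇒Avoids321 w (λ i j l i<j j<l j<i l<j → no321 (Fin.suc i) (Fin.suc j) (Fin.suc l) (s≤s i<j) (s≤s j<l) j<i l<j)

  Avoids321⇒No321 : ∀ {k} (v : Vec (Fin n) k) → Avoids321 (values v) → No321 v
  Avoids321⇒No321 (a ∷ w) (no21 , _)    Fin.zero    (Fin.suc j) (Fin.suc l) _         (s≤s j<l) j<i l<j = no21 (Has21Below-values⁺ w j l j<l j<i l<j)
  Avoids321⇒No321 (a ∷ w) (_ , avoids) (Fin.suc i) (Fin.suc j) (Fin.suc l) (s≤s i<j) (s≤s j<l) j<i l<j =
    Avoids321⇒No321 w avoids i j l i<j j<l j<i l<j

  isPerm⇒DistinctEntries : (π : Vec (Fin n) n) → Bool.T (isPerm π) → DistinctEntries π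
  isPerm⇒DistinctEntries π perm i j i<j πi≡πj
    with i Fin.<? j | lookup π i Fin.≟ lookup π j | All.lookup (all⁺ _ _ (All.lookup (all⁺ _ _ perm) (∈-allFin i))) (∈-allFin j)
  ... | no  i≮j | _        | _  = i≮j i<j
  ... | yes _   | no πi≢πj | _  = πi≢πj πi≡πj
  ... | yes _   | yes _    | ()

  DistinctEntries⇒isPerm : (π : Vec (Fin n) n) → DistinctEntries π → Bool.T (isPerm π)
  DistinctEntries⇒isPerm π distinct with T? (isPerm π)
  ... | yes perm = perm
  ... | no ¬perm with ¬all⇒∃¬ _ (allFin n) ¬perm
  ...   | i , ¬row with ¬all⇒∃¬ _ (allFin n) ¬row
  ...     | j , ¬pair with i Fin.<? j | lookup π i Fin.≟ lookup π j | ¬pair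
  ...       | no  _   | _        | ¬t = ⊥-elim (¬t tt)
  ...       | yes _   | no _     | ¬t = ⊥-elim (¬t tt)
  ...       | yes i<j | yes πi≡πj | _ = ⊥-elim (distinct i j i<j πi≡πj)

  pattern321ᵇ : Vec (Fin n) n → Fin n → Fin n → Fin n → Bool
  pattern321ᵇ π i j l = ⌊ i Fin.<? j ⌋ ∧ ⌊ j Fin.<? l ⌋ ∧ ⌊ lookup π j Fin.<? lookup π i ⌋ ∧ ⌊ lookup π l Fin.<? lookup π j ⌋

  pattern321ᵇ-sound : ∀ π i j l → Bool.T (pattern321ᵇ π i j l) →
    i Fin.< j × j Fin.< l × lookup π j Fin.< lookup π i × lookup π l Fin.< lookup π j
  pattern321ᵇ-sound π i j l is321 with i Fin.<? j | j Fin.<? l | lookup π j Fin.<? lookup π i | lookup π l Fin.<? lookup π j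
  ... | yes i<j | yes j<l | yes j<i | yes l<j = i<j , j<l , j<i , l<j
  ... | no _    | _       | _       | _       = ⊥-elim is321
  ... | yes _   | no _    | _       | _       = ⊥-elim is321
  ... | yes _   | yes _   | no _    | _       = ⊥-elim is321
  ... | yes _   | yes _   | yes _   | no _    = ⊥-elim is321

  pattern321ᵇ-complete : ∀ π i j l → i Fin.< j → j Fin.< l → lookup π j Fin.< lookup π i → lookup π l Fin.< lookup π j →
    Bool.T (pattern321ᵇ π i j l)
  pattern321ᵇ-complete π i j l i<j j<l j<i l<j with i Fin.<? j | j Fin.<? l | lookup π j Fin.<? lookup π i | lookup π l Fin.<? lookup π j
  ... | yes _ | yes _ | yes _ | yes _ = tt
  ... | no ¬p | _     | _     | _     = ¬p i<j
  ... | yes _ | no ¬p | _     | _     = ¬p j<l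
  ... | yes _ | yes _ | no ¬p | _     = ¬p j<i
  ... | yes _ | yes _ | yes _ | no ¬p = ¬p l<j

  avoids321⇒No321 : (π : Vec (Fin n) n) → Bool.T (avoids321 π) → No321 π
  avoids321⇒No321 π avoids i j l i<j j<l j<i l<j = T-not⇒¬T avoids
    (any⁺ _ (lose (∈-allFin i) (any⁺ _ (lose (∈-allFin j) (any⁺ (pattern321ᵇ π i j) (lose (∈-allFin l)
      (pattern321ᵇ-complete π i j l i<j j<l j<i l<j)))))))

  No321⇒avoids321 : (π : Vec (Fin n) n) → No321 π → Bool.T (avoids321 π)
  No321⇒avoids321 π no321 = ¬T⇒T-not λ some →
    let i , some-i = satisfied (any⁻ (λ i → any (λ j → any (pattern321ᵇ π i j) (allFin n)) (allFin n)) (allFin n) some)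
        j , some-j = satisfied (any⁻ (λ j → any (pattern321ᵇ π i j) (allFin n)) (allFin n) some-i)
        l , is321  = satisfied (any⁻ (pattern321ᵇ π i j) (allFin n) some-j)
        i<j , j<l , j<i , l<j = pattern321ᵇ-sound π i j l is321
    in no321 i j l i<j j<l j<i l<j

  DistinctEntries⇒complete : (π : Vec (Fin n) n) → DistinctEntries π → ∀ {b} → b < n → b ∈ values π
  DistinctEntries⇒complete π distinct {b} b<n with injective⇒surjective (lookup π) distinct (fromℕ< b<n)
  ... | i , πi≡b = subst (_∈ values π) (trans (cong toℕ πi≡b) (Finₚ.toℕ-fromℕ< b<n)) (lookup-∈-values π i)

  permutation⇒Admissible : (π : Vec (Fin n) n) → Bool.T (isPerm π ∧ avoids321 π) → Admissible (values π)
  permutation⇒Admissible π perm321 = permutation-suffix⇒Admissible [] (values π)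
    (DistinctEntries⇒Distinct π distinct) (No321⇒Avoids321 π (avoids321⇒No321 π (proj₂ perm×avoids)))
    (DistinctEntries⇒complete π distinct) (values<n π)
    where
    perm×avoids = Equivalence.to T-∧ perm321
    distinct = isPerm⇒DistinctEntries π (proj₁ perm×avoids)

  Admissible⇒permutation : (π : Vec (Fin n) n) → Admissible (values π) → Bool.T (isPerm π ∧ avoids321 π)
  Admissible⇒permutation π adm = Equivalence.from T-∧
    ( DistinctEntries⇒isPerm π (Distinct⇒DistinctEntries π (Admissible⇒Distinct (values π) adm))
    , No321⇒avoids321 π (Avoids321⇒No321 π (Admissible⇒Avoids321 (values π) adm)))

  fixFactor-at : ∀ {a o k} → o ℕ.+ suc k ≡ n → fixFactor a k ≡ (if does (a ℕₚ.≟ o) then x else 1ℚ)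
  fixFactor-at {a} {o} {k} o+1+k≡n with a ℕₚ.≟ o
  ... | yes a≡o = trans (fixFactor-fixed {a} {k} (trans (cong (λ z → suc (z ℕ.+ k)) a≡o) (trans (sym (ℕₚ.+-suc o k)) o+1+k≡n)))
                       (cong (λ b → if b then x else 1ℚ) (sym (dec-true (a ℕₚ.≟ o) a≡o)))
  ... | no  a≢o = trans (fixFactor-moved {a} {k} (λ fixed →
                          a≢o (ℕₚ.+-cancelʳ-≡ (suc k) a o (trans (ℕₚ.+-suc a k) (trans fixed (sym o+1+k≡n))))))
                       (cong (λ b → if b then x else 1ℚ) (sym (dec-false (a ℕₚ.≟ o) a≢o)))

  ^ℚ-if : ∀ b c → x ^ℚ ((if b then 1 else 0) ℕ.+ c) ≡ (if b then x else 1ℚ) * x ^ℚ c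
  ^ℚ-if true  c = refl
  ^ℚ-if false c = sym (ℚₚ.*-identityˡ (x ^ℚ c))

  -- The entry of index i of a suffix starting at position o is a fixed point iff its value is i + o.
  x^fixed≡suffixWeight : ∀ {k} o (v : Vec (Fin n) k) → o ℕ.+ k ≡ n →
    x ^ℚ countᵇ (λ i → does (toℕ (lookup v i) ℕₚ.≟ toℕ i ℕ.+ o)) ≡ suffixWeight (values v)
  x^fixed≡suffixWeight o []      _        = refl
  x^fixed≡suffixWeight o (a ∷ w) o+k≡n = begin
    x ^ℚ ((if does (toℕ a ℕₚ.≟ o) then 1 else 0) ℕ.+ countᵇ (λ i → does (toℕ (lookup w i) ℕₚ.≟ suc (toℕ i ℕ.+ o))))
      ≡⟨ cong (λ c → x ^ℚ ((if does (toℕ a ℕₚ.≟ o) then 1 else 0) ℕ.+ c))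
              (countᵇ-cong (λ i → cong (λ m → does (toℕ (lookup w i) ℕₚ.≟ m)) (sym (ℕₚ.+-suc (toℕ i) o)))) ⟩
    x ^ℚ ((if does (toℕ a ℕₚ.≟ o) then 1 else 0) ℕ.+ countᵇ (λ i → does (toℕ (lookup w i) ℕₚ.≟ toℕ i ℕ.+ suc o)))
      ≡⟨ ^ℚ-if (does (toℕ a ℕₚ.≟ o)) _ ⟩
    (if does (toℕ a ℕₚ.≟ o) then x else 1ℚ) * x ^ℚ countᵇ (λ i → does (toℕ (lookup w i) ℕₚ.≟ toℕ i ℕ.+ suc o))
      ≡⟨ cong₂ _*_ (sym (fixFactor-at (trans (cong (λ k → o ℕ.+ suc k) (length-values w)) o+k≡n)))
                   (x^fixed≡suffixWeight (suc o) w (trans (sym (ℕₚ.+-suc o _)) o+k≡n)) ⟩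
    fixFactor (toℕ a) (length (values w)) * suffixWeight (values w) ∎

  x^fix≡suffixWeight : (π : Vec (Fin n) n) → x ^ℚ fix π ≡ suffixWeight (values π)
  x^fix≡suffixWeight π = begin
    x ^ℚ fix π
      ≡⟨ cong (x ^ℚ_) (length-filterᵇ-tabulate (λ i → ⌊ lookup π i Fin.≟ i ⌋) (λ i → i)) ⟩
    x ^ℚ countᵇ (λ i → ⌊ lookup π i Fin.≟ i ⌋)
      ≡⟨ cong (x ^ℚ_) (countᵇ-cong fixed?≡) ⟩
    x ^ℚ countᵇ (λ i → does (toℕ (lookup π i) ℕₚ.≟ toℕ i ℕ.+ 0))
      ≡⟨ x^fixed≡suffixWeight 0 π refl ⟩
    suffixWeight (values π) ∎
    where
    fixed?≡ : ∀ i → ⌊ lookup π i Fin.≟ i ⌋ ≡ does (toℕ (lookup π i) ℕₚ.≟ toℕ i ℕ.+ 0)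
    fixed?≡ i with lookup π i Fin.≟ i
    ... | yes πi≡i = sym (dec-true (_ ℕₚ.≟ _) (trans (cong toℕ πi≡i) (sym (ℕₚ.+-identityʳ (toℕ i)))))
    ... | no  πi≢i = sym (dec-false (_ ℕₚ.≟ _) (λ πi≡i → πi≢i (Finₚ.toℕ-injective (trans πi≡i (ℕₚ.+-identityʳ (toℕ i))))))

  sumℚ-allWords : ∀ j (H : List ℕ → ℚ) → sumℚ (map (H ∘ values) (allWords j n)) ≡ ∑words j H
  sumℚ-allWords zero    H = ℚₚ.+-identityʳ (H [])
  sumℚ-allWords (suc j) H = begin
    sumℚ (map (H ∘ values) (concatMap prepend (allWords j n)))
      ≡⟨ sumℚ-concatMap (H ∘ values) prepend (allWords j n) ⟩
    sumℚ (map (λ v → sumℚ (map (H ∘ values) (prepend v))) (allWords j n))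
      ≡⟨ cong sumℚ (Listₚ.map-cong sum-prepend (allWords j n)) ⟩
    sumℚ (map (λ v → ∑< n (λ i → H (i ∷ values v))) (allWords j n))
      ≡⟨ sumℚ-allWords j (λ l → ∑< n (λ i → H (i ∷ l))) ⟩
    ∑words (suc j) H ∎
    where
    prepend : Vec (Fin n) j → List (Vec (Fin n) (suc j))
    prepend v = map (_∷ v) (allFin n)
    sum-prepend : ∀ v → sumℚ (map (H ∘ values) (prepend v)) ≡ ∑< n (λ i → H (i ∷ values v))
    sum-prepend v = trans (cong sumℚ (sym (Listₚ.map-∘ (allFin n)))) (sumℚ-allFin n (λ i → H (i ∷ values v)))

  score-values : (π : Vec (Fin n) n) → (if isPerm π ∧ avoids321 π then x ^ℚ fix π else 0ℚ) ≡ score (values π)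
  score-values π with isPerm π ∧ avoids321 π in perm321≡
  ... | true  = trans (x^fix≡suffixWeight π) (sym (whenAdmissible-yes (values π) (permutation⇒Admissible π (subst Bool.T (sym perm321≡) tt))))
  ... | false = sym (whenAdmissible-no (values π) (λ adm → subst Bool.T perm321≡ (Admissible⇒permutation π adm)))

  A≡∑words-score : A n x ≡ ∑words n score
  A≡∑words-score = begin
    A n x
      ≡⟨ sumℚ-filterᵇ (λ π → isPerm π ∧ avoids321 π) (λ π → x ^ℚ fix π) (allWords n n) ⟩
    sumℚ (map (λ π → if isPerm π ∧ avoids321 π then x ^ℚ fix π else 0ℚ) (allWords n n))
      ≡⟨ cong sumℚ (Listₚ.map-cong score-values (allWords n n)) ⟩
    sumℚ (map (score ∘ values) (allWords n n))
      ≡⟨ sumℚ-allWords n score ⟩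
    ∑words n score ∎

theorem4p1 : (n : ℕ) (x : ℚ) → .{{_ : NonZero (denom x 0)}} →
    A n x ≡ seriesDiv (numer x) (denom x) n
theorem4p1 n x = begin
  A n x                                     ≡⟨ Permutations.A≡∑words-score n x ⟩
  ∑words n score                            ≡⟨ ∑words-score≡T ⟩
  T x n 0                                   ≡⟨ T≡seriesDiv x n ⟩
  seriesDiv (numer x) (denom x) n           ∎
  where open Completions n x
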